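{- There exists a convenient subspecies $\mathrm{Bool}_{\mathrm{max}}$ of $\mathrm{Bool}$ which is maximal for inclusion among convenient subspecies.
   Context: A boolean function on a finite set $X$ is a map $f:\mathcal{P}(X)\to\mathbb{Z}$ with $f(\emptyset)=0$; $\mathrm{Bool}(X)$ is the set of them; $1$ is the unique element of $\mathrm{Bool}(\emptyset)$. A set subspecies $\mathrm{Bool}_{\mathrm{t}}$ assigns to each finite set $X$ a subset $\mathrm{Bool}_{\mathrm{t}}(X)\subseteq\mathrm{Bool}(X)$ stable under relabelling by bijections. $f_{\mid Y}$ denotes restriction to $\mathcal{P}(Y)$; for disjoint $X,Y$, $f\star_1 g(A)=f(A\cap X)+g(A\cap Y)$. For nonempty $X$, $f$ is indecomposable if $f=f'\star_1f''$ with $f'\in\mathrm{Bool}(X\setminus Y)$, $f''\in\mathrm{Bool}(Y)$ forces $Y\in\{\emptyset,X\}$. $\sim_f^i$ is the unique equivalence on $X$ such that $f$ is the $\star_1$-product of the $f_{\mid Y}$ over its classes, each indecomposable; $\mathrm{ic}(f)$ is its number of classes ($\mathrm{ic}(1)=0$). For an equivalence $\sim$ on $X$ ($\varpi_\sim$ the projection, $\mathrm{cl}(\sim)$ its number of classes): $f/{\sim}(A)=f(\varpi_\sim^{ -1}(A))$ for $A\subseteq X/{\sim}$, $f\mid\sim(A)=\sum_{Y\in X/\sim}f(A\cap Y)$. $\mathcal{E}^W(f)=\{\sim:\mathrm{ic}(f\mid\sim)=\mathrm{cl}(\sim)\}$, $\mathcal{E}^S(f)=\{\sim\in\mathcal{E}^W(f):\mathrm{ic}(f/{\sim})=\mathrm{ic}(f)\}$.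 A set subspecies $\mathrm{Bool}_{\mathrm{t}}$ is convenient if: $1\in\mathrm{Bool}_{\mathrm{t}}(\emptyset)$; it is stable under $\star_1$; $f_{\mid Y}\in\mathrm{Bool}_{\mathrm{t}}(Y)$ whenever $Y\subseteq X$, $f\in\mathrm{Bool}_{\mathrm{t}}(X)$; $f/{\sim}\in\mathrm{Bool}_{\mathrm{t}}(X/{\sim})$ whenever $f\in\mathrm{Bool}_{\mathrm{t}}(X)$ and $\sim\in\mathcal{E}^W(f)$; and $\mathcal{E}^W(f)=\mathcal{E}^S(f)$ for every $f\in\mathrm{Bool}_{\mathrm{t}}(X)$. -}

module Defs where

open import Level using (0ℓ)
open import Data.Nat using (ℕ; zero; suc; _+_)
open import Data.Integer using (ℤ; 0ℤ) renaming (_+_ to _+ℤ_)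
open import Data.Fin using (Fin; zero; suc; _≟_)
open import Data.Fin.Properties using (any?)
open import Data.Fin.Subset using (Subset; ⁅_⁆; _∩_; _─_; _⊆_; Nonempty)
  renaming (⊥ to ∅)
open import Data.Fin.Subset.Properties using (_∈?_)
open import Data.Vec using (tabulate; lookup; take; drop)
open import Data.Product using (Σ; ∃; _×_; _,_)
open import Data.Sum using (_⊎_)
open import Relation.Nullary.Decidable using (⌊_⌋; _×-dec_)
open import Relation.Binary.PropositionalEquality using (_≡_)
open import Function.Bundles using (_↔_; Inverse)
open import Function.Definitions using (Injective; Surjective)

-- Finite sets are represented by their canonical representatives Fin n;
-- subsets of Fin n are Data.Fin.Subset (boolean vectors).

BoolFn : ℕ → Set
BoolFn n = Subset n → ℤ

IsBool : ∀ {n} → BoolFn n → Set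
IsBool f = f ∅ ≡ 0ℤ

one : BoolFn 0
one _ = 0ℤ

preimage : ∀ {n m} → (Fin n → Fin m) → Subset m → Subset n
preimage h B = tabulate (λ i → lookup B (h i))

image : ∀ {k n} → (Fin k → Fin n) → Subset k → Subset n
image ι A = tabulate (λ j → ⌊ any? (λ i → (i ∈? A) ×-dec (ι i ≟ j)) ⌋)

∑ : ∀ {c} → (Fin c → ℤ) → ℤ
∑ {zero}  g = 0ℤ
∑ {suc c} g = g zero +ℤ ∑ (λ j → g (suc j))

-- f ⋆₁ g on the disjoint union Fin n ⊔ Fin m ≅ Fin (n + m)
_⋆₁_ : ∀ {n m} → BoolFn n → BoolFn m → BoolFn (n + m)
_⋆₁_ {n} f g A = f (take n A) +ℤ g (drop n A)

-- An equivalence relation ∼ on Fin n with cl(∼) = c is represented by a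
-- surjective projection ϖ : Fin n → Fin c (classes labelled by Fin c).
-- The class of label j:
cls : ∀ {n c} → (Fin n → Fin c) → Fin c → Subset n
cls ϖ j = preimage ϖ ⁅ j ⁆

_/∼_ : ∀ {n c} → BoolFn n → (Fin n → Fin c) → BoolFn c
(f /∼ ϖ) A = f (preimage ϖ A)

_∣∼_ : ∀ {n c} → BoolFn n → (Fin n → Fin c) → BoolFn n
(f ∣∼ ϖ) A = ∑ (λ j → f (A ∩ cls ϖ j))

-- Indecomposability of the restriction f_{|Y} (Y ⊆ Fin n nonempty):
-- whenever f_{|Y} = f' ⋆₁ f'' with f' ∈ Bool(Y ∖ Z), f'' ∈ Bool(Z), Z ⊆ Y,
-- then Z = ∅ or Z = Y.  (f', f'' are only evaluated on subsets of Y∖Z, Z.)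
IndecOn : ∀ {n} → BoolFn n → Subset n → Set
IndecOn {n} f Y =
  Nonempty Y ×
  (∀ (Z : Subset n) → Z ⊆ Y → ∀ (f' f'' : BoolFn n) → IsBool f' → IsBool f'' →
     (∀ A → A ⊆ Y → f A ≡ f' (A ∩ (Y ─ Z)) +ℤ f'' (A ∩ Z)) →
     Z ≡ ∅ ⊎ Z ≡ Y)

-- ϖ describes ∼ⁱ_f : f is the ⋆₁-product of its restrictions to the classes,
-- each restriction being indecomposable.
IsIcPartition : ∀ {n c} → BoolFn n → (Fin n → Fin c) → Set
IsIcPartition f ϖ = Surjective _≡_ _≡_ ϖ × (∀ A → f A ≡ (f ∣∼ ϖ) A) × (∀ j → IndecOn f (cls ϖ j))

HasIc : ∀ {n} → BoolFn n → ℕ → Set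
HasIc {n} f k = Σ (Fin n → Fin k) (λ ϖ → IsIcPartition f ϖ)

InEW : ∀ {n c} → BoolFn n → (Fin n → Fin c) → Set
InEW {c = c} f ϖ = HasIc (f ∣∼ ϖ) c

InES : ∀ {n c} → BoolFn n → (Fin n → Fin c) → Set
InES f ϖ = InEW f ϖ × ∃ (λ k → HasIc (f /∼ ϖ) k × HasIc f k)

-- set subspecies of Bool: subsets T(Fin n) ⊆ Bool(Fin n), stable under relabelling
-- by bijections σ : Fin n ≅ Fin m  (σ_* f)(B) = f(σ⁻¹(B))  (and under
-- pointwise equality of functions).
record Subspecies : Set₁ where
  field
    T        : ∀ n → BoolFn n → Set
    T⊆Bool   : ∀ {n} {f : BoolFn n} → T n f → IsBool f
    relabel  : ∀ {n m} (σ : Fin n ↔ Fin m) {f : BoolFn n} {g : BoolFn m} →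
               (∀ B → g B ≡ f (preimage (Inverse.to σ) B)) → T n f → T m g
open Subspecies public

_⊑_ : Subspecies → Subspecies → Set
S ⊑ S' = ∀ n (f : BoolFn n) → T S n f → T S' n f

record Convenient (S : Subspecies) : Set where
  field
    unit     : T S 0 one
    star     : ∀ {n m} {f : BoolFn n} {g : BoolFn m} → T S n f → T S m g → T S (n + m) (f ⋆₁ g)
    -- restriction to Y ⊆ Fin n, Y identified with Fin k through an injection ι with image Y
    restrict : ∀ {k n} (ι : Fin k → Fin n) → Injective _≡_ _≡_ ι →
               {f : BoolFn n} → T S n f → T S k (λ A → f (image ι A))
    quotient : ∀ {n c} (ϖ : Fin n → Fin c) → Surjective _≡_ _≡_ ϖ →
               {f : BoolFn n} → T S n f → InEW f ϖ → T S c (f /∼ ϖ)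
    EW⊆ES    : ∀ {n c} (ϖ : Fin n → Fin c) → Surjective _≡_ _≡_ ϖ →
               {f : BoolFn n} → T S n f → InEW f ϖ → InES f ϖ

-- The greatest convenient subspecies consists of the hereditarily good boolean functions: those h
-- such that every function derived from h (by restrictions to subsets and quotients along relations
-- in 𝓔^W, up to relabelling) satisfies 𝓔^W = 𝓔^S.  A convenient subspecies contains the derived
-- functions of its members, so it lies inside; closure under restriction and 𝓔^W-quotients holds by
-- construction.  The substance is closure under ⋆₁.  Every function derived from f ⋆₁ g is still,
-- up to relabelling, a ⋆₁-product of a function derived from f and one derived from g: an
-- indecomposable block never straddles a splitting set, so a quotient along ∼ ∈ 𝓔^W respects the
-- splitting and induces quotients in 𝓔^W on both factors.  As ic is additive over a splitting,
-- 𝓔^W = 𝓔^S for the factors gives it for the product.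

{-# OPTIONS --safe #-}
module Submission where

open import Defs
open import Data.Product using (Σ; _×_)
open import Data.Product using (∃; _,_; proj₁; proj₂)
open import Data.Nat using (zero; suc; _+_)
open import Data.Nat.Properties using (<-irrefl)
open import Data.Integer using (ℤ; 0ℤ) renaming (_+_ to _+ℤ_)
open import Data.Integer.Properties using (+-identityˡ; +-identityʳ; +-assoc; +-comm; +-commutativeSemigroup)
open import Algebra.Properties.CommutativeSemigroup +-commutativeSemigroup using (interchange)
open import Data.Bool using (true; false; _∧_; not)
open import Data.Bool.Properties using (∧-zeroʳ; ∧-identityʳ; ⇔→≡)
open import Data.Fin using (Fin; zero; suc; _↑ˡ_; _↑ʳ_; punchOut; _≟_)
open import Data.Fin.Properties using (any?; suc-injective; ↑ˡ-injective; ↑ʳ-injective; injective⇒≤; punchOut-injective)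
open import Data.Fin.Subset using (Subset; ⁅_⁆; _∩_; _─_; _⊆_; _∈_; Nonempty; ∁; ∣_∣; ⊤) renaming (⊥ to ∅)
open import Data.Fin.Subset.Properties using (_∈?_; x∈p∩q⁻; p∩q⊆p; p∩q⊆q; ⊆-refl; ∩-comm; ∩-identityʳ; ∩-zeroˡ; ∩-zeroʳ; p─⊥≡p; p─⊤≡⊥)
open import Data.Vec using (_∷_; lookup; tabulate; take; drop)
open import Data.Vec.Properties
  using (lookup-zipWith; lookup-map; lookup-replicate; lookup∘tabulate; tabulate∘lookup; tabulate-cong; []=⇒lookup; lookup⇒[]=)
open import Data.Sum using (_⊎_; inj₁; inj₂)
import Data.Sum as Sum
open import Data.Empty using (⊥; ⊥-elim)
open import Relation.Nullary using (¬_; Dec; yes; no; does; _×-dec_)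
open import Relation.Nullary.Decidable using (dec-true; dec-false; isYes≗does)
open import Relation.Binary.PropositionalEquality
open import Function.Bundles using (_↔_; Inverse; mk⇔)
open import Function.Definitions using (Injective; Surjective)
open import Function.Base using (_∘_)
open import Function.Construct.Identity using (↔-id)

subset-ext : ∀ {n} {p q : Subset n} → (∀ i → lookup p i ≡ lookup q i) → p ≡ q
subset-ext {p = p} {q} p≗q = trans (sym (tabulate∘lookup p)) (trans (tabulate-cong p≗q) (tabulate∘lookup q))

lookup-∩ : ∀ {n} (p q : Subset n) i → lookup (p ∩ q) i ≡ lookup p i ∧ lookup q i
lookup-∩ p q i = lookup-zipWith _∧_ i p q

lookup-─ : ∀ {n} (p q : Subset n) i → lookup (p ─ q) i ≡ lookup p i ∧ not (lookup q i)
lookup-─ (x ∷ p) (true  ∷ q) zero    = sym (∧-zeroʳ x)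
lookup-─ (x ∷ p) (false ∷ q) zero    = sym (∧-identityʳ x)
lookup-─ (_ ∷ p) (_     ∷ q) (suc i) = lookup-─ p q i

lookup-∁ : ∀ {n} (p : Subset n) i → lookup (∁ p) i ≡ not (lookup p i)
lookup-∁ p i = lookup-map i not p

lookup-∅ : ∀ {n} (i : Fin n) → lookup ∅ i ≡ false
lookup-∅ i = lookup-replicate i false

lookup-preimage : ∀ {n m} (h : Fin n → Fin m) B i → lookup (preimage h B) i ≡ lookup B (h i)
lookup-preimage h B i = lookup∘tabulate (λ i → lookup B (h i)) i

lookup-⁅⁆ : ∀ {n} (j i : Fin n) → lookup ⁅ j ⁆ i ≡ does (i ≟ j)
lookup-⁅⁆ zero    zero    = refl
lookup-⁅⁆ zero    (suc i) = lookup-∅ i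
lookup-⁅⁆ (suc j) zero    = refl
lookup-⁅⁆ (suc j) (suc i) = lookup-⁅⁆ j i

does-true : ∀ {P : Set} (P? : Dec P) → does P? ≡ true → P
does-true (yes p) _ = p

⊆-lookup⁺ : ∀ {n} {p q : Subset n} → (∀ i → lookup p i ≡ true → lookup q i ≡ true) → p ⊆ q
⊆-lookup⁺ {p = p} {q} h {i} i∈p = lookup⇒[]= i q (h i ([]=⇒lookup i∈p))

⊆-lookup⁻ : ∀ {n} {p q : Subset n} → p ⊆ q → ∀ i → lookup p i ≡ true → lookup q i ≡ true
⊆-lookup⁻ {p = p} p⊆q i pᵢ = []=⇒lookup (p⊆q (lookup⇒[]= i p pᵢ))

≡-lookup : ∀ {n} {p q : Subset n} → (∀ i → lookup p i ≡ true → lookup q i ≡ true) →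
           (∀ i → lookup q i ≡ true → lookup p i ≡ true) → p ≡ q
≡-lookup p⊆q q⊆p = subset-ext (λ i → ⇔→≡ (mk⇔ (p⊆q i) (q⊆p i)))

∩-∁ : ∀ {n} (A Q : Subset n) → A ∩ ∁ Q ≡ A ─ Q
∩-∁ A Q = subset-ext λ i →
  trans (lookup-∩ A (∁ Q) i) (trans (cong (lookup A i ∧_) (lookup-∁ Q i)) (sym (lookup-─ A Q i)))

∩-congˡ-on : ∀ {n} {A : Subset n} Y → A ⊆ Y → ∀ B C → (∀ i → lookup Y i ≡ true → lookup B i ≡ lookup C i) →
             A ∩ B ≡ A ∩ C
∩-congˡ-on {A = A} Y A⊆Y B C B≗C = subset-ext λ i →
  trans (lookup-∩ A B i) (trans (on-A i) (sym (lookup-∩ A C i)))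
  where
  on-A : ∀ i → lookup A i ∧ lookup B i ≡ lookup A i ∧ lookup C i
  on-A i with lookup A i in Aᵢ
  ... | true  = B≗C i (⊆-lookup⁻ A⊆Y i Aᵢ)
  ... | false = refl

true≢false : true ≢ false
true≢false ()

lookup-∅-false : ∀ {n} (i : Fin n) → lookup ∅ i ≢ true
lookup-∅-false i ∅ᵢ = true≢false (trans (sym ∅ᵢ) (lookup-∅ i))

lookup-cls : ∀ {n c} (ϖ : Fin n → Fin c) j i → lookup (cls ϖ j) i ≡ does (ϖ i ≟ j)
lookup-cls ϖ j i = trans (lookup-preimage ϖ ⁅ j ⁆ i) (lookup-⁅⁆ j (ϖ i))

lookup-cls-≡ : ∀ {n c} (ϖ : Fin n → Fin c) {j i} → ϖ i ≡ j → lookup (cls ϖ j) i ≡ true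
lookup-cls-≡ ϖ {j} {i} ϖi≡j = trans (lookup-cls ϖ j i) (dec-true (ϖ i ≟ j) ϖi≡j)

lookup-cls-≢ : ∀ {n c} (ϖ : Fin n → Fin c) {j i} → ϖ i ≢ j → lookup (cls ϖ j) i ≡ false
lookup-cls-≢ ϖ {j} {i} ϖi≢j = trans (lookup-cls ϖ j i) (dec-false (ϖ i ≟ j) ϖi≢j)

lookup-cls-true : ∀ {n c} (ϖ : Fin n → Fin c) {j i} → lookup (cls ϖ j) i ≡ true → ϖ i ≡ j
lookup-cls-true ϖ {j} {i} i∈j = does-true (ϖ i ≟ j) (trans (sym (lookup-cls ϖ j i)) i∈j)

preimage-∅ : ∀ {n m} (h : Fin n → Fin m) → preimage h ∅ ≡ ∅
preimage-∅ h = subset-ext λ i → trans (lookup-preimage h ∅ i) (trans (lookup-∅ (h i)) (sym (lookup-∅ i)))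

preimage-∩ : ∀ {n m} (h : Fin n → Fin m) A B → preimage h (A ∩ B) ≡ preimage h A ∩ preimage h B
preimage-∩ h A B = subset-ext λ i → begin
  lookup (preimage h (A ∩ B)) i                      ≡⟨ lookup-preimage h (A ∩ B) i ⟩
  lookup (A ∩ B) (h i)                               ≡⟨ lookup-∩ A B (h i) ⟩
  lookup A (h i) ∧ lookup B (h i)                    ≡⟨ cong₂ _∧_ (lookup-preimage h A i) (lookup-preimage h B i) ⟨
  lookup (preimage h A) i ∧ lookup (preimage h B) i  ≡⟨ lookup-∩ (preimage h A) (preimage h B) i ⟨
  lookup (preimage h A ∩ preimage h B) i             ∎
  where open ≡-Reasoning

preimage-∁ : ∀ {n m} (h : Fin n → Fin m) A → preimage h (∁ A) ≡ ∁ (preimage h A)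
preimage-∁ h A = subset-ext λ i →
  trans (lookup-preimage h (∁ A) i)
        (trans (lookup-∁ A (h i)) (trans (cong not (sym (lookup-preimage h A i))) (sym (lookup-∁ (preimage h A) i))))

preimage-─ : ∀ {n m} (h : Fin n → Fin m) A B → preimage h (A ─ B) ≡ preimage h A ─ preimage h B
preimage-─ h A B = begin
  preimage h (A ─ B)                  ≡⟨ cong (preimage h) (∩-∁ A B) ⟨
  preimage h (A ∩ ∁ B)                ≡⟨ preimage-∩ h A (∁ B) ⟩
  preimage h A ∩ preimage h (∁ B)     ≡⟨ cong (preimage h A ∩_) (preimage-∁ h B) ⟩
  preimage h A ∩ ∁ (preimage h B)     ≡⟨ ∩-∁ (preimage h A) (preimage h B) ⟩
  preimage h A ─ preimage h B         ∎
  where open ≡-Reasoning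

preimage-mono : ∀ {n m} (h : Fin n → Fin m) {A B} → A ⊆ B → preimage h A ⊆ preimage h B
preimage-mono h {A} {B} A⊆B = ⊆-lookup⁺ λ i hA∋i →
  trans (lookup-preimage h B i) (⊆-lookup⁻ A⊆B (h i) (trans (sym (lookup-preimage h A i)) hA∋i))

module _ {k n} (ι : Fin k → Fin n) where

  ∈image? : ∀ A j → Dec (∃ λ i → i ∈ A × ι i ≡ j)
  ∈image? A j = any? (λ i → (i ∈? A) ×-dec (ι i ≟ j))

  lookup-image : ∀ A j → lookup (image ι A) j ≡ does (∈image? A j)
  lookup-image A j = trans (lookup∘tabulate _ j) (isYes≗does _)

  InRange : Subset n → Set
  InRange A = ∀ j → lookup A j ≡ true → ∃ λ i → ι i ≡ j

  lookup-image-true : ∀ A j → lookup (image ι A) j ≡ true → ∃ λ i → lookup A i ≡ true × ι i ≡ j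
  lookup-image-true A j ιA∋j
    with does-true (∈image? A j) (trans (sym (lookup-image A j)) ιA∋j)
  ... | i , i∈A , ιi≡j = i , []=⇒lookup i∈A , ιi≡j

  lookup-image-∉range : ∀ A j → (∀ i → ι i ≢ j) → lookup (image ι A) j ≡ false
  lookup-image-∉range A j j∉ι =
    trans (lookup-image A j) (dec-false (∈image? A j) (λ (i , _ , ιi≡j) → j∉ι i ιi≡j))

  image-inRange : ∀ A → InRange (image ι A)
  image-inRange A j ιA∋j = let i , _ , ιi≡j = lookup-image-true A j ιA∋j in i , ιi≡j

  image-∅ : image ι ∅ ≡ ∅
  image-∅ = ≡-lookup (λ j ι∅∋j → let i , ∅∋i , _ = lookup-image-true ∅ j ι∅∋j in ⊥-elim (lookup-∅-false i ∅∋i))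
                     (λ j ∅∋j → ⊥-elim (lookup-∅-false j ∅∋j))

module _ {k n} (ι : Fin k → Fin n) (ι-inj : Injective _≡_ _≡_ ι) where

  lookup-image-at : ∀ A i → lookup (image ι A) (ι i) ≡ lookup A i
  lookup-image-at A i with lookup A i in Aᵢ
  ... | true  = trans (lookup-image ι A (ι i)) (dec-true (∈image? ι A (ι i)) (i , lookup⇒[]= i A Aᵢ , refl))
  ... | false = trans (lookup-image ι A (ι i)) (dec-false (∈image? ι A (ι i)) λ (i′ , i′∈A , ιi′≡ιi) →
                  true≢false (trans (sym ([]=⇒lookup i′∈A)) (trans (cong (lookup A) (ι-inj ιi′≡ιi)) Aᵢ)))

  image-unique : ∀ X W → (∀ i → lookup W (ι i) ≡ lookup X i) → (∀ j → (∀ i → ι i ≢ j) → lookup W j ≡ false) →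
                 image ι X ≡ W
  image-unique X W on-range off-range = subset-ext pointwise
    where
    pointwise : ∀ j → lookup (image ι X) j ≡ lookup W j
    pointwise j with any? (λ i → ι i ≟ j)
    ... | yes (i , refl) = trans (lookup-image-at X i) (sym (on-range i))
    ... | no ¬j∈ι        = trans (lookup-image-∉range ι X j j∉ι) (sym (off-range j j∉ι))
      where j∉ι = λ i ιi≡j → ¬j∈ι (i , ιi≡j)

  preimage-image : ∀ A → preimage ι (image ι A) ≡ A
  preimage-image A = subset-ext λ i → trans (lookup-preimage ι (image ι A) i) (lookup-image-at A i)

  image-preimage : ∀ A → InRange ι A → image ι (preimage ι A) ≡ A
  image-preimage A A⊆ι = image-unique _ A (λ i → sym (lookup-preimage ι A i)) off-range
    where
    off-range : ∀ j → (∀ i → ι i ≢ j) → lookup A j ≡ false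
    off-range j j∉ι with lookup A j in Aⱼ
    ... | true  = ⊥-elim (let i , ιi≡j = A⊆ι j Aⱼ in j∉ι i ιi≡j)
    ... | false = refl

  image-mono : ∀ {A Y} → A ⊆ Y → image ι A ⊆ image ι Y
  image-mono {A} {Y} A⊆Y = ⊆-lookup⁺ λ j ιA∋j → let i , Aᵢ , ιi≡j = lookup-image-true ι A j ιA∋j in
    subst (λ j → lookup (image ι Y) j ≡ true) ιi≡j (trans (lookup-image-at Y i) (⊆-lookup⁻ A⊆Y i Aᵢ))

  image-∩-preimage : ∀ A P → image ι (A ∩ preimage ι P) ≡ image ι A ∩ P
  image-∩-preimage A P = image-unique _ _ on-range off-range
    where
    open ≡-Reasoning
    on-range : ∀ i → lookup (image ι A ∩ P) (ι i) ≡ lookup (A ∩ preimage ι P) i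
    on-range i = begin
      lookup (image ι A ∩ P) (ι i)               ≡⟨ lookup-∩ (image ι A) P (ι i) ⟩
      lookup (image ι A) (ι i) ∧ lookup P (ι i)  ≡⟨ cong₂ _∧_ (lookup-image-at A i) (sym (lookup-preimage ι P i)) ⟩
      lookup A i ∧ lookup (preimage ι P) i       ≡⟨ lookup-∩ A (preimage ι P) i ⟨
      lookup (A ∩ preimage ι P) i                ∎
    off-range : ∀ j → (∀ i → ι i ≢ j) → lookup (image ι A ∩ P) j ≡ false
    off-range j j∉ι = trans (lookup-∩ (image ι A) P j) (cong (_∧ lookup P j) (lookup-image-∉range ι A j j∉ι))

  image-─-preimage : ∀ A P → image ι (A ─ preimage ι P) ≡ image ι A ─ P
  image-─-preimage A P = begin
    image ι (A ─ preimage ι P)        ≡⟨ cong (image ι) (∩-∁ A (preimage ι P)) ⟨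
    image ι (A ∩ ∁ (preimage ι P))    ≡⟨ cong (λ U → image ι (A ∩ U)) (preimage-∁ ι P) ⟨
    image ι (A ∩ preimage ι (∁ P))    ≡⟨ image-∩-preimage A (∁ P) ⟩
    image ι A ∩ ∁ P                   ≡⟨ ∩-∁ (image ι A) P ⟩
    image ι A ─ P                     ∎
    where open ≡-Reasoning

  image-∩ : ∀ A B → image ι (A ∩ B) ≡ image ι A ∩ image ι B
  image-∩ A B = trans (cong (λ B → image ι (A ∩ B)) (sym (preimage-image B))) (image-∩-preimage A (image ι B))

  image-─ : ∀ A B → image ι (A ─ B) ≡ image ι A ─ image ι B
  image-─ A B = trans (cong (λ B → image ι (A ─ B)) (sym (preimage-image B))) (image-─-preimage A (image ι B))

image-image : ∀ {k l n} {α : Fin l → Fin n} {β : Fin k → Fin l} {γ : Fin k → Fin n} →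
              Injective _≡_ _≡_ α → Injective _≡_ _≡_ β → (∀ x → α (β x) ≡ γ x) →
              ∀ A → image α (image β A) ≡ image γ A
image-image {α = α} {β} {γ} α-inj β-inj αβ≗γ A = sym (image-unique γ γ-inj A _ on-range off-range)
  where
  γ-inj : Injective _≡_ _≡_ γ
  γ-inj {x} {y} γx≡γy = β-inj (α-inj (trans (αβ≗γ x) (trans γx≡γy (sym (αβ≗γ y)))))
  on-range : ∀ x → lookup (image α (image β A)) (γ x) ≡ lookup A x
  on-range x = begin
    lookup (image α (image β A)) (γ x)      ≡⟨ cong (lookup (image α (image β A))) (αβ≗γ x) ⟨
    lookup (image α (image β A)) (α (β x))  ≡⟨ lookup-image-at α α-inj (image β A) (β x) ⟩
    lookup (image β A) (β x)                ≡⟨ lookup-image-at β β-inj A x ⟩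
    lookup A x                              ∎
    where open ≡-Reasoning
  off-range : ∀ j → (∀ x → γ x ≢ j) → lookup (image α (image β A)) j ≡ false
  off-range j j∉γ with any? (λ y → α y ≟ j)
  ... | no ¬j∈α        = lookup-image-∉range α (image β A) j (λ y αy≡j → ¬j∈α (y , αy≡j))
  ... | yes (y , refl) = trans (lookup-image-at α α-inj (image β A) y)
                               (lookup-image-∉range β A y (λ x βx≡y → j∉γ x (trans (sym (αβ≗γ x)) (cong α βx≡y))))

∑-cong : ∀ {c} {g h : Fin c → ℤ} → (∀ j → g j ≡ h j) → ∑ g ≡ ∑ h
∑-cong {zero}  g≗h = refl
∑-cong {suc c} g≗h = cong₂ _+ℤ_ (g≗h zero) (∑-cong (λ j → g≗h (suc j)))

∑-distrib-+ : ∀ {c} (g h : Fin c → ℤ) → ∑ (λ j → g j +ℤ h j) ≡ ∑ g +ℤ ∑ h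
∑-distrib-+ {zero}  g h = refl
∑-distrib-+ {suc c} g h =
  trans (cong ((g zero +ℤ h zero) +ℤ_) (∑-distrib-+ (λ j → g (suc j)) (λ j → h (suc j))))
        (interchange (g zero) (h zero) _ _)

∑-0 : ∀ {c} (g : Fin c → ℤ) → (∀ j → g j ≡ 0ℤ) → ∑ g ≡ 0ℤ
∑-0 {zero}  g g≗0 = refl
∑-0 {suc c} g g≗0 = cong₂ _+ℤ_ (g≗0 zero) (∑-0 (λ j → g (suc j)) (λ j → g≗0 (suc j)))

∑-supported-at : ∀ {c} (g : Fin c → ℤ) j → (∀ j′ → j′ ≢ j → g j′ ≡ 0ℤ) → ∑ g ≡ g j
∑-supported-at {suc c} g zero    g≗0 =
  trans (cong (g zero +ℤ_) (∑-0 (λ j → g (suc j)) (λ j → g≗0 (suc j) λ ()))) (+-identityʳ (g zero))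
∑-supported-at {suc c} g (suc j) g≗0 =
  trans (cong (_+ℤ ∑ (λ j → g (suc j))) (g≗0 zero λ ()))
        (trans (+-identityˡ _) (∑-supported-at (λ j → g (suc j)) j (λ j′ j′≢j → g≗0 (suc j′) (j′≢j ∘ suc-injective))))

data SplitView k₁ k₂ : Fin (k₁ + k₂) → Set where
  fromˡ : (a : Fin k₁) → SplitView k₁ k₂ (a ↑ˡ k₂)
  fromʳ : (b : Fin k₂) → SplitView k₁ k₂ (k₁ ↑ʳ b)

splitView : ∀ k₁ k₂ y → SplitView k₁ k₂ y
splitView zero     k₂ y       = fromʳ y
splitView (suc k₁) k₂ zero    = fromˡ zero
splitView (suc k₁) k₂ (suc y) with splitView k₁ k₂ y
... | fromˡ a = fromˡ (suc a)
... | fromʳ b = fromʳ b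

↑ˡ≢↑ʳ : ∀ {k₁ k₂} (a : Fin k₁) (b : Fin k₂) → a ↑ˡ k₂ ≢ k₁ ↑ʳ b
↑ˡ≢↑ʳ {suc k₁} zero    b ()
↑ˡ≢↑ʳ {suc k₁} (suc a) b eq = ↑ˡ≢↑ʳ a b (suc-injective eq)

∑-++ : ∀ k₁ k₂ (g : Fin (k₁ + k₂) → ℤ) → ∑ g ≡ ∑ (λ a → g (a ↑ˡ k₂)) +ℤ ∑ (λ b → g (k₁ ↑ʳ b))
∑-++ zero     k₂ g = sym (+-identityˡ _)
∑-++ (suc k₁) k₂ g = trans (cong (g zero +ℤ_) (∑-++ k₁ k₂ (λ j → g (suc j)))) (sym (+-assoc (g zero) _ _))

section : ∀ {n c} {ϖ : Fin n → Fin c} → Surjective _≡_ _≡_ ϖ → Fin c → Fin n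
section ϖ-surj y = proj₁ (ϖ-surj y)

section-inverse : ∀ {n c} {ϖ : Fin n → Fin c} (ϖ-surj : Surjective _≡_ _≡_ ϖ) y → ϖ (section ϖ-surj y) ≡ y
section-inverse ϖ-surj y = proj₂ (ϖ-surj y) refl

injective-endo-hits : ∀ {c} (ψ : Fin c → Fin c) → Injective _≡_ _≡_ ψ → ∀ r → ¬ (∀ j → ψ j ≢ r)
injective-endo-hits {suc c} ψ ψ-inj r r∉ψ = <-irrefl refl (injective⇒≤ punchOut∘ψ-inj)
  where
  punchOut∘ψ-inj : Injective _≡_ _≡_ (λ j → punchOut (r∉ψ j ∘ sym))
  punchOut∘ψ-inj eq = ψ-inj (punchOut-injective (r∉ψ _ ∘ sym) (r∉ψ _ ∘ sym) eq)

surjective⇒injective : ∀ {c} (φ : Fin c → Fin c) → Surjective _≡_ _≡_ φ → Injective _≡_ _≡_ φ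
surjective⇒injective φ φ-surj {a} {b} φa≡φb = via-section (hit a) (hit b)
  where
  ψ = section φ-surj
  ψ-inj : Injective _≡_ _≡_ ψ
  ψ-inj {x} {y} ψx≡ψy = trans (sym (section-inverse φ-surj x)) (trans (cong φ ψx≡ψy) (section-inverse φ-surj y))
  hit : ∀ x → ∃ λ y → ψ y ≡ x
  hit x with any? (λ y → ψ y ≟ x)
  ... | yes x∈ψ = x∈ψ
  ... | no x∉ψ  = ⊥-elim (injective-endo-hits ψ ψ-inj x (λ y ψy≡x → x∉ψ (y , ψy≡x)))
  via-section : (∃ λ y → ψ y ≡ a) → (∃ λ y → ψ y ≡ b) → a ≡ b
  via-section (y₁ , refl) (y₂ , refl) =
    cong ψ (trans (sym (section-inverse φ-surj y₁)) (trans φa≡φb (section-inverse φ-surj y₂)))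

enum : ∀ {n} (P : Subset n) → Fin ∣ P ∣ → Fin n
enum (true  ∷ P) zero    = zero
enum (true  ∷ P) (suc x) = suc (enum P x)
enum (false ∷ P) x       = suc (enum P x)

index : ∀ {n} (P : Subset n) j → lookup P j ≡ true → Fin ∣ P ∣
index (true  ∷ P) zero    _  = zero
index (true  ∷ P) (suc j) Pⱼ = suc (index P j Pⱼ)
index (false ∷ P) (suc j) Pⱼ = index P j Pⱼ

enum-index : ∀ {n} (P : Subset n) j (Pⱼ : lookup P j ≡ true) → enum P (index P j Pⱼ) ≡ j
enum-index (true  ∷ P) zero    _  = refl
enum-index (true  ∷ P) (suc j) Pⱼ = cong suc (enum-index P j Pⱼ)
enum-index (false ∷ P) (suc j) Pⱼ = cong suc (enum-index P j Pⱼ)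

enum-member : ∀ {n} (P : Subset n) x → lookup P (enum P x) ≡ true
enum-member (true  ∷ P) zero    = refl
enum-member (true  ∷ P) (suc x) = enum-member P x
enum-member (false ∷ P) x       = enum-member P x

enum-injective : ∀ {n} (P : Subset n) → Injective _≡_ _≡_ (enum P)
enum-injective (true  ∷ P) {zero}  {zero}  _  = refl
enum-injective (true  ∷ P) {suc x} {suc y} eq = cong suc (enum-injective P (suc-injective eq))
enum-injective (false ∷ P)                 eq = enum-injective P (suc-injective eq)

enum-∉ : ∀ {n} (P : Subset n) {j} → lookup P j ≡ false → ∀ x → enum P x ≢ j
enum-∉ P Pⱼ x refl = true≢false (trans (sym (enum-member P x)) Pⱼ)

∉enum : ∀ {n} (P : Subset n) j → (∀ x → enum P x ≢ j) → lookup P j ≡ false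
∉enum P j j∉P with lookup P j in Pⱼ
... | true  = ⊥-elim (j∉P (index P j Pⱼ) (enum-index P j Pⱼ))
... | false = refl

lookup-∁-true : ∀ {n} (P : Subset n) {j} → lookup P j ≡ false → lookup (∁ P) j ≡ true
lookup-∁-true P {j} Pⱼ = trans (lookup-∁ P j) (cong not Pⱼ)

lookup-∁-false : ∀ {n} (P : Subset n) {j} → lookup P j ≡ true → lookup (∁ P) j ≡ false
lookup-∁-false P {j} Pⱼ = trans (lookup-∁ P j) (cong not Pⱼ)

member-or-∁ : ∀ {n} (P : Subset n) j → lookup P j ≡ true ⊎ lookup (∁ P) j ≡ true
member-or-∁ P j with lookup P j in Pⱼ
... | true  = inj₁ refl
... | false = inj₂ (lookup-∁-true P Pⱼ)

data EnumView {n} (P : Subset n) : Fin n → Set where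
  inside  : ∀ x → EnumView P (enum P x)
  outside : ∀ x → EnumView P (enum (∁ P) x)

enumView : ∀ {n} (P : Subset n) j → EnumView P j
enumView P j with member-or-∁ P j
... | inj₁ Pⱼ  = subst (EnumView P) (enum-index P j Pⱼ) (inside _)
... | inj₂ ∁Pⱼ = subst (EnumView P) (enum-index (∁ P) j ∁Pⱼ) (outside _)

copair : ∀ {n} {X : Set} (P : Subset n) → (Fin ∣ P ∣ → X) → (Fin ∣ ∁ P ∣ → X) → Fin n → X
copair P g₁ g₂ j with member-or-∁ P j
... | inj₁ Pⱼ  = g₁ (index P j Pⱼ)
... | inj₂ ∁Pⱼ = g₂ (index (∁ P) j ∁Pⱼ)

copair-inside : ∀ {n} {X : Set} (P : Subset n) g₁ (g₂ : Fin ∣ ∁ P ∣ → X) x → copair P g₁ g₂ (enum P x) ≡ g₁ x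
copair-inside P g₁ g₂ x with member-or-∁ P (enum P x)
... | inj₁ Pⱼ  = cong g₁ (enum-injective P (enum-index P (enum P x) Pⱼ))
... | inj₂ ∁Pⱼ = ⊥-elim (true≢false (trans (sym ∁Pⱼ) (lookup-∁-false P (enum-member P x))))

copair-outside : ∀ {n} {X : Set} (P : Subset n) (g₁ : Fin ∣ P ∣ → X) g₂ x → copair P g₁ g₂ (enum (∁ P) x) ≡ g₂ x
copair-outside P g₁ g₂ x with member-or-∁ P (enum (∁ P) x)
... | inj₁ Pⱼ  = ⊥-elim (true≢false (trans (sym (enum-member (∁ P) x)) (lookup-∁-false P Pⱼ)))
... | inj₂ ∁Pⱼ = cong g₂ (enum-injective (∁ P) (enum-index (∁ P) (enum (∁ P) x) ∁Pⱼ))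

image-enum-preimage : ∀ {n} (P A : Subset n) → image (enum P) (preimage (enum P) A) ≡ A ∩ P
image-enum-preimage P A = image-unique (enum P) (enum-injective P) _ _ on-range off-range
  where
  on-range : ∀ x → lookup (A ∩ P) (enum P x) ≡ lookup (preimage (enum P) A) x
  on-range x = trans (lookup-∩ A P (enum P x))
                     (trans (cong (lookup A (enum P x) ∧_) (enum-member P x))
                            (trans (∧-identityʳ _) (sym (lookup-preimage (enum P) A x))))
  off-range : ∀ j → (∀ x → enum P x ≢ j) → lookup (A ∩ P) j ≡ false
  off-range j j∉P = trans (lookup-∩ A P j) (trans (cong (lookup A j ∧_) (∉enum P j j∉P)) (∧-zeroʳ _))

restrictAlong : ∀ {k n} → (Fin k → Fin n) → BoolFn n → BoolFn k
restrictAlong ι e A = e (image ι A)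

_↾_ : ∀ {n} → BoolFn n → (P : Subset n) → BoolFn ∣ P ∣
e ↾ P = restrictAlong (enum P) e

-- e = e|Q ⋆₁ e|∁Q in the notation of the paper.
Splits : ∀ {n} → BoolFn n → Subset n → Set
Splits e Q = ∀ A → e A ≡ e (A ∩ Q) +ℤ e (A ─ Q)

IsBool-restrictAlong : ∀ {k n} (ι : Fin k → Fin n) (e : BoolFn n) → IsBool e → IsBool (restrictAlong ι e)
IsBool-restrictAlong ι e e∅≡0 = trans (cong e (image-∅ ι)) e∅≡0

IsBool-/∼ : ∀ {n c} (ϖ : Fin n → Fin c) (e : BoolFn n) → IsBool e → IsBool (e /∼ ϖ)
IsBool-/∼ ϖ e e∅≡0 = trans (cong e (preimage-∅ ϖ)) e∅≡0

IndecOn-cong : ∀ {n} {e e′ : BoolFn n} {Y} → (∀ A → A ⊆ Y → e A ≡ e′ A) → IndecOn e Y → IndecOn e′ Y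
IndecOn-cong e≗e′ (Y≢∅ , indec) =
  Y≢∅ , λ Z Z⊆Y f′ f″ f′∅ f″∅ e′≡⋆ → indec Z Z⊆Y f′ f″ f′∅ f″∅ (λ A A⊆Y → trans (e≗e′ A A⊆Y) (e′≡⋆ A A⊆Y))

HasIc-cong : ∀ {n k} {e e′ : BoolFn n} → (∀ A → e A ≡ e′ A) → HasIc e k → HasIc e′ k
HasIc-cong {e = e} {e′} e≗e′ (ρ , ρ-surj , e≡∣∼ , ρ-indec) =
  ρ , ρ-surj ,
  (λ A → trans (sym (e≗e′ A)) (trans (e≡∣∼ A) (∑-cong (λ j → e≗e′ (A ∩ cls ρ j))))) ,
  (λ j → IndecOn-cong (λ A _ → e≗e′ A) (ρ-indec j))

indecomposable-on-one-side : ∀ {n} {h : BoolFn n} {Y} Q → IsBool h → IndecOn h Y → Splits h Q →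
                              Y ∩ Q ≡ ∅ ⊎ Y ∩ Q ≡ Y
indecomposable-on-one-side {h = h} {Y} Q h∅ (_ , indec) h-splits =
  indec (Y ∩ Q) (p∩q⊆p Y Q) h h h∅ h∅ λ A A⊆Y → begin
    h A                                         ≡⟨ h-splits A ⟩
    h (A ∩ Q) +ℤ h (A ─ Q)                      ≡⟨ +-comm (h (A ∩ Q)) _ ⟩
    h (A ─ Q) +ℤ h (A ∩ Q)                      ≡⟨ cong₂ _+ℤ_ (cong h (outside-Q A A⊆Y)) (cong h (inside-Q A A⊆Y)) ⟨
    h (A ∩ (Y ─ Y ∩ Q)) +ℤ h (A ∩ (Y ∩ Q))      ∎
  where
  open ≡-Reasoning
  inside-Q : ∀ A → A ⊆ Y → A ∩ (Y ∩ Q) ≡ A ∩ Q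
  inside-Q A A⊆Y = ∩-congˡ-on Y A⊆Y _ Q λ i Yᵢ → trans (lookup-∩ Y Q i) (cong (_∧ lookup Q i) Yᵢ)
  outside-Q : ∀ A → A ⊆ Y → A ∩ (Y ─ Y ∩ Q) ≡ A ─ Q
  outside-Q A A⊆Y = trans (∩-congˡ-on Y A⊆Y _ (∁ Q) λ i Yᵢ → begin
      lookup (Y ─ Y ∩ Q) i                         ≡⟨ lookup-─ Y (Y ∩ Q) i ⟩
      lookup Y i ∧ not (lookup (Y ∩ Q) i)          ≡⟨ cong (λ y → lookup Y i ∧ not y) (lookup-∩ Y Q i) ⟩
      lookup Y i ∧ not (lookup Y i ∧ lookup Q i)   ≡⟨ cong (λ y → y ∧ not (y ∧ lookup Q i)) Yᵢ ⟩
      not (lookup Q i)                             ≡⟨ lookup-∁ Q i ⟨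
      lookup (∁ Q) i                               ∎)
    (∩-∁ A Q)

module _ {k n} (ι : Fin k → Fin n) (ι-inj : Injective _≡_ _≡_ ι) {e : BoolFn n} where

  image-injective : ∀ {A B} → image ι A ≡ image ι B → A ≡ B
  image-injective {A} {B} ιA≡ιB =
    trans (sym (preimage-image ι ι-inj A)) (trans (cong (preimage ι) ιA≡ιB) (preimage-image ι ι-inj B))

  preimage-∩-image : ∀ A B → preimage ι (A ∩ image ι B) ≡ preimage ι A ∩ B
  preimage-∩-image A B = trans (preimage-∩ ι A (image ι B)) (cong (preimage ι A ∩_) (preimage-image ι ι-inj B))

  preimage-⊆ : ∀ {A Y} → A ⊆ image ι Y → preimage ι A ⊆ Y
  preimage-⊆ {A} {Y} A⊆ιY = subst (preimage ι A ⊆_) (preimage-image ι ι-inj Y) (preimage-mono ι A⊆ιY)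

  ⊆image⇒InRange : ∀ {A Y} → A ⊆ image ι Y → InRange ι A
  ⊆image⇒InRange {Y = Y} A⊆ιY j Aⱼ = image-inRange ι Y j (⊆-lookup⁻ A⊆ιY j Aⱼ)

  IndecOn-restrictAlong : ∀ {Y} → IndecOn e (image ι Y) → IndecOn (restrictAlong ι e) Y
  IndecOn-restrictAlong {Y} ((j , j∈ιY) , indec) = Y≢∅ , indec′
    where
    Y≢∅ : Nonempty Y
    Y≢∅ = let i , Yᵢ , _ = lookup-image-true ι Y j ([]=⇒lookup j∈ιY) in i , lookup⇒[]= i Y Yᵢ
    indec′ : ∀ Z → Z ⊆ Y → ∀ f′ f″ → IsBool f′ → IsBool f″ →
             (∀ A → A ⊆ Y → e (image ι A) ≡ f′ (A ∩ (Y ─ Z)) +ℤ f″ (A ∩ Z)) → Z ≡ ∅ ⊎ Z ≡ Y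
    indec′ Z Z⊆Y f′ f″ f′∅ f″∅ e≡⋆ =
      Sum.map (λ ιZ≡∅ → image-injective (trans ιZ≡∅ (sym (image-∅ ι)))) image-injective
        (indec (image ι Z) (image-mono ι ι-inj Z⊆Y) (λ B → f′ (preimage ι B)) (λ B → f″ (preimage ι B))
               (IsBool-/∼ ι f′ f′∅) (IsBool-/∼ ι f″ f″∅) e≡⋆′)
      where
      e≡⋆′ : ∀ A → A ⊆ image ι Y →
             e A ≡ f′ (preimage ι (A ∩ (image ι Y ─ image ι Z))) +ℤ f″ (preimage ι (A ∩ image ι Z))
      e≡⋆′ A A⊆ιY = begin
        e A                                                   ≡⟨ cong e (image-preimage ι ι-inj A (⊆image⇒InRange A⊆ιY)) ⟨
        e (image ι (preimage ι A))                            ≡⟨ e≡⋆ (preimage ι A) (preimage-⊆ A⊆ιY) ⟩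
        f′ (preimage ι A ∩ (Y ─ Z)) +ℤ f″ (preimage ι A ∩ Z)  ≡⟨ cong₂ _+ℤ_ (cong f′ Y─Z-part) (cong f″ (preimage-∩-image A Z)) ⟨
        f′ (preimage ι (A ∩ (image ι Y ─ image ι Z))) +ℤ f″ (preimage ι (A ∩ image ι Z)) ∎
        where
        open ≡-Reasoning
        Y─Z-part : preimage ι (A ∩ (image ι Y ─ image ι Z)) ≡ preimage ι A ∩ (Y ─ Z)
        Y─Z-part = trans (cong (λ U → preimage ι (A ∩ U)) (sym (image-─ ι ι-inj Y Z))) (preimage-∩-image A (Y ─ Z))

  IndecOn-image : ∀ {Y} → IndecOn (restrictAlong ι e) Y → IndecOn e (image ι Y)
  IndecOn-image {Y} ((i , i∈Y) , indec) = ιY≢∅ , indec′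
    where
    ιY≢∅ : Nonempty (image ι Y)
    ιY≢∅ = ι i , lookup⇒[]= (ι i) (image ι Y) (trans (lookup-image-at ι ι-inj Y i) ([]=⇒lookup i∈Y))
    indec′ : ∀ Z → Z ⊆ image ι Y → ∀ f′ f″ → IsBool f′ → IsBool f″ →
             (∀ A → A ⊆ image ι Y → e A ≡ f′ (A ∩ (image ι Y ─ Z)) +ℤ f″ (A ∩ Z)) → Z ≡ ∅ ⊎ Z ≡ image ι Y
    indec′ Z Z⊆ιY f′ f″ f′∅ f″∅ e≡⋆ =
      Sum.map (λ ι⁻¹Z≡∅ → trans (sym ιι⁻¹Z≡Z) (trans (cong (image ι) ι⁻¹Z≡∅) (image-∅ ι)))
              (λ ι⁻¹Z≡Y → trans (sym ιι⁻¹Z≡Z) (cong (image ι) ι⁻¹Z≡Y))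
        (indec (preimage ι Z) (preimage-⊆ Z⊆ιY) (restrictAlong ι f′) (restrictAlong ι f″)
               (IsBool-restrictAlong ι f′ f′∅) (IsBool-restrictAlong ι f″ f″∅) e≡⋆′)
      where
      ιι⁻¹Z≡Z : image ι (preimage ι Z) ≡ Z
      ιι⁻¹Z≡Z = image-preimage ι ι-inj Z (⊆image⇒InRange Z⊆ιY)
      e≡⋆′ : ∀ A → A ⊆ Y → e (image ι A) ≡ f′ (image ι (A ∩ (Y ─ preimage ι Z))) +ℤ f″ (image ι (A ∩ preimage ι Z))
      e≡⋆′ A A⊆Y = begin
        e (image ι A)                                                  ≡⟨ e≡⋆ (image ι A) (image-mono ι ι-inj A⊆Y) ⟩
        f′ (image ι A ∩ (image ι Y ─ Z)) +ℤ f″ (image ι A ∩ Z)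
          ≡⟨ cong₂ (λ U V → f′ (image ι A ∩ U) +ℤ f″ V) (image-─-preimage ι ι-inj Y Z) (image-∩-preimage ι ι-inj A Z) ⟨
        f′ (image ι A ∩ image ι (Y ─ preimage ι Z)) +ℤ f″ (image ι (A ∩ preimage ι Z))
          ≡⟨ cong (λ U → f′ U +ℤ f″ (image ι (A ∩ preimage ι Z))) (image-∩ ι ι-inj A (Y ─ preimage ι Z)) ⟨
        f′ (image ι (A ∩ (Y ─ preimage ι Z))) +ℤ f″ (image ι (A ∩ preimage ι Z)) ∎
        where open ≡-Reasoning

module _ {n c} (ϖ : Fin n → Fin c) where

  ∩-cls-same : ∀ j {A} → A ⊆ cls ϖ j → A ∩ cls ϖ j ≡ A
  ∩-cls-same j {A} A⊆C = trans (∩-congˡ-on (cls ϖ j) A⊆C (cls ϖ j) ⊤ (λ i Cᵢ → trans Cᵢ (sym (lookup-replicate i true))))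
                                 (∩-identityʳ A)

  ∩-cls-other : ∀ j {j′ A} → A ⊆ cls ϖ j → j′ ≢ j → A ∩ cls ϖ j′ ≡ ∅
  ∩-cls-other j {j′} {A} A⊆C j′≢j = trans (∩-congˡ-on (cls ϖ j) A⊆C (cls ϖ j′) ∅ not-in-j′) (∩-zeroʳ A)
    where
    not-in-j′ : ∀ i → lookup (cls ϖ j) i ≡ true → lookup (cls ϖ j′) i ≡ lookup ∅ i
    not-in-j′ i Cᵢ = trans (lookup-cls-≢ ϖ {j′} (λ ϖi≡j′ → j′≢j (trans (sym ϖi≡j′) (lookup-cls-true ϖ {j} Cᵢ))))
                           (sym (lookup-∅ i))

  ─-cls-same : ∀ j A → (A ─ cls ϖ j) ∩ cls ϖ j ≡ ∅
  ─-cls-same j A = trans (∩-comm (A ─ cls ϖ j) (cls ϖ j))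
                         (trans (∩-congˡ-on (cls ϖ j) ⊆-refl (A ─ cls ϖ j) ∅ off-class) (∩-zeroʳ (cls ϖ j)))
    where
    off-class : ∀ i → lookup (cls ϖ j) i ≡ true → lookup (A ─ cls ϖ j) i ≡ lookup ∅ i
    off-class i Cᵢ = trans (lookup-─ A (cls ϖ j) i)
                         (trans (cong (λ b → lookup A i ∧ not b) Cᵢ) (trans (∧-zeroʳ _) (sym (lookup-∅ i))))

  ─-cls-other : ∀ {j j′} A → j′ ≢ j → (A ─ cls ϖ j) ∩ cls ϖ j′ ≡ A ∩ cls ϖ j′
  ─-cls-other {j} {j′} A j′≢j = trans (∩-comm (A ─ cls ϖ j) (cls ϖ j′))
                                     (trans (∩-congˡ-on (cls ϖ j′) ⊆-refl (A ─ cls ϖ j) A off-class) (∩-comm (cls ϖ j′) A))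
    where
    off-class : ∀ i → lookup (cls ϖ j′) i ≡ true → lookup (A ─ cls ϖ j) i ≡ lookup A i
    off-class i C′ᵢ = trans (lookup-─ A (cls ϖ j) i)
      (trans (cong (λ b → lookup A i ∧ not b)
                   (lookup-cls-≢ ϖ {j} (λ ϖi≡j → j′≢j (trans (sym (lookup-cls-true ϖ {j′} C′ᵢ)) ϖi≡j))))
             (∧-identityʳ _))

  module _ (e : BoolFn n) (e∅ : IsBool e) where

    IsBool-∣∼ : IsBool (e ∣∼ ϖ)
    IsBool-∣∼ = ∑-0 _ (λ j → trans (cong e (∩-zeroˡ (cls ϖ j))) e∅)

    ∣∼-on-class : ∀ j {B} → B ⊆ cls ϖ j → (e ∣∼ ϖ) B ≡ e B
    ∣∼-on-class j {B} B⊆C = trans (∑-supported-at _ j (λ j′ j′≢j → trans (cong e (∩-cls-other j B⊆C j′≢j)) e∅))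
                                    (cong e (∩-cls-same j B⊆C))

    ∣∼-splits : ∀ j → Splits (e ∣∼ ϖ) (cls ϖ j)
    ∣∼-splits j A =
      trans (∑-cong per-class) (∑-distrib-+ (λ j′ → e ((A ∩ C) ∩ cls ϖ j′)) (λ j′ → e ((A ─ C) ∩ cls ϖ j′)))
      where
      C = cls ϖ j
      per-class : ∀ j′ → e (A ∩ cls ϖ j′) ≡ e ((A ∩ C) ∩ cls ϖ j′) +ℤ e ((A ─ C) ∩ cls ϖ j′)
      per-class j′ with j′ ≟ j
      ... | yes refl = sym (trans (cong₂ _+ℤ_ (cong e (∩-cls-same j (p∩q⊆q A C))) (trans (cong e (─-cls-same j A)) e∅))
                                  (+-identityʳ _))
      ... | no j′≢j  = sym (trans (cong₂ _+ℤ_ (trans (cong e (∩-cls-other j (p∩q⊆q A C) j′≢j)) e∅)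
                                              (cong e (─-cls-other A j′≢j)))
                                  (+-identityˡ _))

    HasIc-∣∼ : Surjective _≡_ _≡_ ϖ → (∀ j → IndecOn e (cls ϖ j)) → HasIc (e ∣∼ ϖ) c
    HasIc-∣∼ ϖ-surj indec = ϖ , ϖ-surj ,
      (λ A → ∑-cong (λ j → sym (∣∼-on-class j (p∩q⊆q A (cls ϖ j))))) ,
      (λ j → IndecOn-cong (λ A A⊆C → sym (∣∼-on-class j A⊆C)) (indec j))

indecomposable-blocks-refine : ∀ {n c d} {h : BoolFn n} (ρ : Fin n → Fin d) (ϖ : Fin n → Fin c) → IsBool h →
                               (∀ r → IndecOn h (cls ρ r)) → (∀ j → Splits h (cls ϖ j)) →
                               ∀ {i i′} → ρ i ≡ ρ i′ → ϖ i ≡ ϖ i′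
indecomposable-blocks-refine ρ ϖ h∅ indec splits {i} {i′} ρi≡ρi′
  with indecomposable-on-one-side (cls ϖ (ϖ i)) h∅ (indec (ρ i)) (splits (ϖ i))
... | inj₁ Y∩Q≡∅ = ⊥-elim (lookup-∅-false i (subst (λ X → lookup X i ≡ true) Y∩Q≡∅ i∈Y∩Q))
  where
  i∈Y∩Q : lookup (cls ρ (ρ i) ∩ cls ϖ (ϖ i)) i ≡ true
  i∈Y∩Q = trans (lookup-∩ (cls ρ (ρ i)) (cls ϖ (ϖ i)) i) (cong₂ _∧_ (lookup-cls-≡ ρ refl) (lookup-cls-≡ ϖ refl))
... | inj₂ Y∩Q≡Y = sym (lookup-cls-true ϖ ([]=⇒lookup (proj₂ (x∈p∩q⁻ _ _ i′∈Y∩Q))))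
  where
  i′∈Y∩Q : i′ ∈ cls ρ (ρ i) ∩ cls ϖ (ϖ i)
  i′∈Y∩Q = subst (i′ ∈_) (sym Y∩Q≡Y) (lookup⇒[]= i′ _ (lookup-cls-≡ ρ (sym ρi≡ρi′)))

-- ϖ factors as φ ∘ ρ, and φ is a surjective endomap of Fin c, hence injective.
refinement-with-as-many-classes : ∀ {n c} {ρ ϖ : Fin n → Fin c}
                                  (ρ-surj : Surjective _≡_ _≡_ ρ) (ϖ-surj : Surjective _≡_ _≡_ ϖ) →
                                  (∀ {i i′} → ρ i ≡ ρ i′ → ϖ i ≡ ϖ i′) →
                                  ∀ j → cls ϖ j ≡ cls ρ (ρ (section ϖ-surj j))
refinement-with-as-many-classes {ρ = ρ} {ϖ} ρ-surj ϖ-surj refines j = ≡-lookup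
  (λ i i∈j → lookup-cls-≡ ρ (φ-inj (trans (φ∘ρ i) (trans (lookup-cls-true ϖ {j} i∈j) (sym (φ∘ρ∘section j))))))
  (λ i i∈r → lookup-cls-≡ ϖ (trans (refines (lookup-cls-true ρ {ρ (section ϖ-surj j)} i∈r))
                                   (section-inverse ϖ-surj j)))
  where
  φ : _ → _
  φ r = ϖ (section ρ-surj r)
  φ∘ρ : ∀ i → φ (ρ i) ≡ ϖ i
  φ∘ρ i = refines (section-inverse ρ-surj (ρ i))
  φ∘ρ∘section : ∀ j → φ (ρ (section ϖ-surj j)) ≡ j
  φ∘ρ∘section j = trans (φ∘ρ _) (section-inverse ϖ-surj j)
  φ-inj : Injective _≡_ _≡_ φ
  φ-inj = surjective⇒injective φ (λ j → ρ (section ϖ-surj j) , λ { refl → φ∘ρ∘section j })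

InEW⇒IndecOn-classes : ∀ {n c} (e : BoolFn n) (ϖ : Fin n → Fin c) → IsBool e → Surjective _≡_ _≡_ ϖ →
                        InEW e ϖ → ∀ j → IndecOn e (cls ϖ j)
InEW⇒IndecOn-classes e ϖ e∅ ϖ-surj (ρ , ρ-surj , _ , ρ-indec) j =
  IndecOn-cong (λ A A⊆C → ∣∼-on-class ϖ e e∅ j A⊆C)
               (subst (IndecOn (e ∣∼ ϖ)) (sym (same-classes j)) (ρ-indec (ρ (section ϖ-surj j))))
  where
  same-classes : ∀ j → cls ϖ j ≡ cls ρ (ρ (section ϖ-surj j))
  same-classes = refinement-with-as-many-classes ρ-surj ϖ-surj
                   (indecomposable-blocks-refine ρ ϖ (IsBool-∣∼ ϖ e e∅) ρ-indec (∣∼-splits ϖ e e∅))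

image-cls : ∀ {k n c c′} {ι : Fin k → Fin n} {ρ : Fin n → Fin c} {ρ′ : Fin k → Fin c′} {κ : Fin c′ → Fin c} →
            Injective _≡_ _≡_ ι → Injective _≡_ _≡_ κ → (∀ x → ρ (ι x) ≡ κ (ρ′ x)) →
            ∀ a → (∀ j → (∀ x → ι x ≢ j) → ρ j ≢ κ a) → image ι (cls ρ′ a) ≡ cls ρ (κ a)
image-cls {ι = ι} {ρ} {ρ′} {κ} ι-inj κ-inj ρι≡κρ′ a off-range = image-unique ι ι-inj _ _ on-range′ off-range′
  where
  on-range′ : ∀ x → lookup (cls ρ (κ a)) (ι x) ≡ lookup (cls ρ′ a) x
  on-range′ x = ⇔→≡ (mk⇔
    (λ ιx∈κa → lookup-cls-≡ ρ′ (κ-inj (trans (sym (ρι≡κρ′ x)) (lookup-cls-true ρ {κ a} ιx∈κa))))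
    (λ x∈a → lookup-cls-≡ ρ (trans (ρι≡κρ′ x) (cong κ (lookup-cls-true ρ′ {a} x∈a)))))
  off-range′ : ∀ j → (∀ x → ι x ≢ j) → lookup (cls ρ (κ a)) j ≡ false
  off-range′ j j∉ι = lookup-cls-≢ ρ (off-range j j∉ι)

image-preimage-∩ : ∀ {k n} (ι : Fin k → Fin n) → Injective _≡_ _≡_ ι → ∀ A X → image ι (preimage ι A ∩ X) ≡ A ∩ image ι X
image-preimage-∩ ι ι-inj A X = begin
  image ι (preimage ι A ∩ X)  ≡⟨ cong (image ι) (∩-comm (preimage ι A) X) ⟩
  image ι (X ∩ preimage ι A)  ≡⟨ image-∩-preimage ι ι-inj X A ⟩
  image ι X ∩ A               ≡⟨ ∩-comm (image ι X) A ⟩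
  A ∩ image ι X               ∎
  where open ≡-Reasoning

module Glue {n k₁ k₂} (P : Subset n) (ρ₁ : Fin ∣ P ∣ → Fin k₁) (ρ₂ : Fin ∣ ∁ P ∣ → Fin k₂) where

  glued : Fin n → Fin (k₁ + k₂)
  glued = copair P (λ x → ρ₁ x ↑ˡ k₂) (λ x → k₁ ↑ʳ ρ₂ x)

  glued-surjective : Surjective _≡_ _≡_ ρ₁ → Surjective _≡_ _≡_ ρ₂ → Surjective _≡_ _≡_ glued
  glued-surjective ρ₁-surj ρ₂-surj y with splitView k₁ k₂ y
  ... | fromˡ a = enum P (section ρ₁-surj a) ,
                  λ { refl → trans (copair-inside P _ _ _) (cong (_↑ˡ k₂) (section-inverse ρ₁-surj a)) }
  ... | fromʳ b = enum (∁ P) (section ρ₂-surj b) ,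
                  λ { refl → trans (copair-outside P _ _ _) (cong (k₁ ↑ʳ_) (section-inverse ρ₂-surj b)) }

  cls-glued-left : ∀ a → image (enum P) (cls ρ₁ a) ≡ cls glued (a ↑ˡ k₂)
  cls-glued-left a = image-cls (enum-injective P) (↑ˡ-injective k₂ _ _) (copair-inside P _ _) a off-range
    where
    off-range : ∀ j → (∀ x → enum P x ≢ j) → glued j ≢ a ↑ˡ k₂
    off-range j j∉P with enumView P j
    ... | inside x  = ⊥-elim (j∉P x refl)
    ... | outside x = λ ρj≡a → ↑ˡ≢↑ʳ a (ρ₂ x) (trans (sym ρj≡a) (copair-outside P _ _ x))

  cls-glued-right : ∀ b → image (enum (∁ P)) (cls ρ₂ b) ≡ cls glued (k₁ ↑ʳ b)
  cls-glued-right b = image-cls (enum-injective (∁ P)) (↑ʳ-injective k₁ _ _) (copair-outside P _ _) b off-range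
    where
    off-range : ∀ j → (∀ x → enum (∁ P) x ≢ j) → glued j ≢ k₁ ↑ʳ b
    off-range j j∉∁P with enumView P j
    ... | outside x = ⊥-elim (j∉∁P x refl)
    ... | inside x  = λ ρj≡b → ↑ˡ≢↑ʳ (ρ₁ x) b (trans (sym (copair-inside P _ _ x)) ρj≡b)

HasIc-glue : ∀ {n k₁ k₂} (e : BoolFn n) (P : Subset n) → Splits e P →
             HasIc (e ↾ P) k₁ → HasIc (e ↾ ∁ P) k₂ → HasIc e (k₁ + k₂)
HasIc-glue {k₁ = k₁} {k₂} e P e-splits (ρ₁ , ρ₁-surj , e₁≡∣∼ , ρ₁-indec) (ρ₂ , ρ₂-surj , e₂≡∣∼ , ρ₂-indec) =
  glued , glued-surjective ρ₁-surj ρ₂-surj , e≡∣∼ , glued-indec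
  where
  open Glue P ρ₁ ρ₂
  e≡∣∼ : ∀ A → e A ≡ (e ∣∼ glued) A
  e≡∣∼ A = begin
    e A                                                      ≡⟨ e-splits A ⟩
    e (A ∩ P) +ℤ e (A ─ P)
      ≡⟨ cong₂ _+ℤ_ (cong e (image-enum-preimage P A)) (cong e (trans (image-enum-preimage (∁ P) A) (∩-∁ A P))) ⟨
    (e ↾ P) (preimage (enum P) A) +ℤ (e ↾ ∁ P) (preimage (enum (∁ P)) A)
      ≡⟨ cong₂ _+ℤ_ (e₁≡∣∼ _) (e₂≡∣∼ _) ⟩
    ((e ↾ P) ∣∼ ρ₁) (preimage (enum P) A) +ℤ ((e ↾ ∁ P) ∣∼ ρ₂) (preimage (enum (∁ P)) A)
      ≡⟨ cong₂ _+ℤ_ (∑-cong λ a → cong e (trans (image-preimage-∩ (enum P) (enum-injective P) A (cls ρ₁ a))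
                                                (cong (A ∩_) (cls-glued-left a))))
                    (∑-cong λ b → cong e (trans (image-preimage-∩ (enum (∁ P)) (enum-injective (∁ P)) A (cls ρ₂ b))
                                                (cong (A ∩_) (cls-glued-right b)))) ⟩
    ∑ (λ a → e (A ∩ cls glued (a ↑ˡ k₂))) +ℤ ∑ (λ b → e (A ∩ cls glued (k₁ ↑ʳ b)))
      ≡⟨ ∑-++ k₁ k₂ (λ y → e (A ∩ cls glued y)) ⟨
    (e ∣∼ glued) A                                           ∎
    where open ≡-Reasoning
  glued-indec : ∀ y → IndecOn e (cls glued y)
  glued-indec y with splitView k₁ k₂ y
  ... | fromˡ a = subst (IndecOn e) (cls-glued-left a) (IndecOn-image (enum P) (enum-injective P) (ρ₁-indec a))
  ... | fromʳ b = subst (IndecOn e) (cls-glued-right b) (IndecOn-image (enum (∁ P)) (enum-injective (∁ P)) (ρ₂-indec b))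

Splits-/∼ : ∀ {n c} {e : BoolFn n} (ϖ : Fin n → Fin c) {P P′} → preimage ϖ P′ ≡ P → Splits e P → Splits (e /∼ ϖ) P′
Splits-/∼ {e = e} ϖ {P} {P′} ϖ⁻¹P′≡P e-splits B = begin
  e (preimage ϖ B)                                                ≡⟨ e-splits (preimage ϖ B) ⟩
  e (preimage ϖ B ∩ P) +ℤ e (preimage ϖ B ─ P)
    ≡⟨ cong (λ U → e (preimage ϖ B ∩ U) +ℤ e (preimage ϖ B ─ U)) ϖ⁻¹P′≡P ⟨
  e (preimage ϖ B ∩ preimage ϖ P′) +ℤ e (preimage ϖ B ─ preimage ϖ P′)
    ≡⟨ cong₂ _+ℤ_ (cong e (preimage-∩ ϖ B P′)) (cong e (preimage-─ ϖ B P′)) ⟨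
  e (preimage ϖ (B ∩ P′)) +ℤ e (preimage ϖ (B ─ P′))             ∎
  where open ≡-Reasoning

Splits-restrictAlong : ∀ {k n} {e : BoolFn n} (ι : Fin k → Fin n) → Injective _≡_ _≡_ ι → ∀ {P} →
                       Splits e P → Splits (restrictAlong ι e) (preimage ι P)
Splits-restrictAlong {e = e} ι ι-inj {P} e-splits A =
  trans (e-splits (image ι A))
        (sym (cong₂ _+ℤ_ (cong e (image-∩-preimage ι ι-inj A P)) (cong e (image-─-preimage ι ι-inj A P))))

module _ {n c} (e : BoolFn n) (ϖ : Fin n → Fin c) (ϖ-surj : Surjective _≡_ _≡_ ϖ) (e∅ : IsBool e)
         (classes-indec : ∀ j → IndecOn e (cls ϖ j)) where

  Splits⇒saturated : ∀ {P} → Splits e P → ∀ {i i′} → ϖ i ≡ ϖ i′ → lookup P i ≡ lookup P i′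
  Splits⇒saturated {P} e-splits {i} {i′} ϖi≡ϖi′ =
    trans (via-class i refl) (trans (constant-on-class (indecomposable-on-one-side P e∅ (classes-indec (ϖ i)) e-splits))
                                    (sym (via-class i′ (sym ϖi≡ϖi′))))
    where
    Y = cls ϖ (ϖ i)
    via-class : ∀ x → ϖ x ≡ ϖ i → lookup P x ≡ lookup (Y ∩ P) x
    via-class x ϖx≡ϖi = sym (trans (lookup-∩ Y P x) (cong (_∧ lookup P x) (lookup-cls-≡ ϖ ϖx≡ϖi)))
    constant-on-class : Y ∩ P ≡ ∅ ⊎ Y ∩ P ≡ Y → lookup (Y ∩ P) i ≡ lookup (Y ∩ P) i′
    constant-on-class (inj₁ Y∩P≡∅) rewrite Y∩P≡∅ = trans (lookup-∅ i) (sym (lookup-∅ i′))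
    constant-on-class (inj₂ Y∩P≡Y) rewrite Y∩P≡Y = trans (lookup-cls-≡ ϖ refl) (sym (lookup-cls-≡ ϖ (sym ϖi≡ϖi′)))

  -- Independent of the chosen section as soon as P is a union of classes (Splits⇒saturated).
  quotientSubset : Subset n → Subset c
  quotientSubset P = tabulate (λ j → lookup P (section ϖ-surj j))

  preimage-quotientSubset : ∀ {P} → Splits e P → preimage ϖ (quotientSubset P) ≡ P
  preimage-quotientSubset {P} e-splits = subset-ext λ i →
    trans (lookup-preimage ϖ (quotientSubset P) i)
          (trans (lookup∘tabulate (λ j → lookup P (section ϖ-surj j)) (ϖ i))
                 (Splits⇒saturated e-splits (section-inverse ϖ-surj (ϖ i))))

  module QuotientOnBlock (Q : Subset n) (Q′ : Subset c) (ϖ⁻¹Q′≡Q : preimage ϖ Q′ ≡ Q) where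

    private
      ϖ-enum-in-Q′ : ∀ x → lookup Q′ (ϖ (enum Q x)) ≡ true
      ϖ-enum-in-Q′ x = trans (sym (lookup-preimage ϖ Q′ (enum Q x)))
                             (trans (cong (λ U → lookup U (enum Q x)) ϖ⁻¹Q′≡Q) (enum-member Q x))

    ϖ↾ : Fin ∣ Q ∣ → Fin ∣ Q′ ∣
    ϖ↾ x = index Q′ (ϖ (enum Q x)) (ϖ-enum-in-Q′ x)

    enum-ϖ↾ : ∀ x → enum Q′ (ϖ↾ x) ≡ ϖ (enum Q x)
    enum-ϖ↾ x = enum-index Q′ _ (ϖ-enum-in-Q′ x)

    ∉Q⇒ϖ∉Q′ : ∀ j → (∀ x → enum Q x ≢ j) → lookup Q′ (ϖ j) ≡ false
    ∉Q⇒ϖ∉Q′ j j∉Q = trans (sym (lookup-preimage ϖ Q′ j)) (trans (cong (λ U → lookup U j) ϖ⁻¹Q′≡Q) (∉enum Q j j∉Q))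

    ϖ↾-surjective : Surjective _≡_ _≡_ ϖ↾
    ϖ↾-surjective y = index Q i i∈Q , λ { refl → enum-injective Q′ (begin
        enum Q′ (ϖ↾ (index Q i i∈Q))  ≡⟨ enum-ϖ↾ _ ⟩
        ϖ (enum Q (index Q i i∈Q))    ≡⟨ cong ϖ (enum-index Q i i∈Q) ⟩
        ϖ i                           ≡⟨ section-inverse ϖ-surj (enum Q′ y) ⟩
        enum Q′ y                     ∎) }
      where
      open ≡-Reasoning
      i = section ϖ-surj (enum Q′ y)
      i∈Q : lookup Q i ≡ true
      i∈Q = trans (cong (λ U → lookup U i) (sym ϖ⁻¹Q′≡Q))
                  (trans (lookup-preimage ϖ Q′ i) (trans (cong (lookup Q′) (section-inverse ϖ-surj _)) (enum-member Q′ y)))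

    cls-ϖ↾ : ∀ y → image (enum Q) (cls ϖ↾ y) ≡ cls ϖ (enum Q′ y)
    cls-ϖ↾ y = image-cls (enum-injective Q) (enum-injective Q′) (λ x → sym (enum-ϖ↾ x)) y
      λ j j∉Q ϖj≡y → true≢false (trans (sym (enum-member Q′ y)) (trans (cong (lookup Q′) (sym ϖj≡y)) (∉Q⇒ϖ∉Q′ j j∉Q)))

    ϖ↾-InEW : InEW (e ↾ Q) ϖ↾
    ϖ↾-InEW = HasIc-∣∼ ϖ↾ (e ↾ Q) (IsBool-restrictAlong (enum Q) e e∅) ϖ↾-surjective λ y →
      IndecOn-restrictAlong (enum Q) (enum-injective Q) (subst (IndecOn e) (sym (cls-ϖ↾ y)) (classes-indec (enum Q′ y)))

    /∼-↾ : ∀ B → ((e /∼ ϖ) ↾ Q′) B ≡ ((e ↾ Q) /∼ ϖ↾) B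
    /∼-↾ B = cong e (sym (image-unique (enum Q) (enum-injective Q) _ _ on-range off-range))
      where
      on-range : ∀ x → lookup (preimage ϖ (image (enum Q′) B)) (enum Q x) ≡ lookup (preimage ϖ↾ B) x
      on-range x = begin
        lookup (preimage ϖ (image (enum Q′) B)) (enum Q x)  ≡⟨ lookup-preimage ϖ (image (enum Q′) B) (enum Q x) ⟩
        lookup (image (enum Q′) B) (ϖ (enum Q x))           ≡⟨ cong (lookup (image (enum Q′) B)) (enum-ϖ↾ x) ⟨
        lookup (image (enum Q′) B) (enum Q′ (ϖ↾ x))         ≡⟨ lookup-image-at (enum Q′) (enum-injective Q′) B (ϖ↾ x) ⟩
        lookup B (ϖ↾ x)                                     ≡⟨ lookup-preimage ϖ↾ B x ⟨
        lookup (preimage ϖ↾ B) x                            ∎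
        where open ≡-Reasoning
      off-range : ∀ j → (∀ x → enum Q x ≢ j) → lookup (preimage ϖ (image (enum Q′) B)) j ≡ false
      off-range j j∉Q = trans (lookup-preimage ϖ (image (enum Q′) B) j)
                              (lookup-image-∉range (enum Q′) B (ϖ j) (enum-∉ Q′ (∉Q⇒ϖ∉Q′ j j∉Q)))

module RestrictionOnBlock {k n} (ι : Fin k → Fin n) (ι-inj : Injective _≡_ _≡_ ι)
                          (Q : Subset n) (Q′ : Subset k) (ι⁻¹Q≡Q′ : preimage ι Q ≡ Q′) where

  private
    ι-enum-in-Q : ∀ x → lookup Q (ι (enum Q′ x)) ≡ true
    ι-enum-in-Q x = trans (sym (lookup-preimage ι Q (enum Q′ x)))
                          (trans (cong (λ U → lookup U (enum Q′ x)) ι⁻¹Q≡Q′) (enum-member Q′ x))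

  ι↾ : Fin ∣ Q′ ∣ → Fin ∣ Q ∣
  ι↾ x = index Q (ι (enum Q′ x)) (ι-enum-in-Q x)

  enum-ι↾ : ∀ x → enum Q (ι↾ x) ≡ ι (enum Q′ x)
  enum-ι↾ x = enum-index Q _ (ι-enum-in-Q x)

  ι↾-injective : Injective _≡_ _≡_ ι↾
  ι↾-injective {x} {y} ι↾x≡ι↾y =
    enum-injective Q′ (ι-inj (trans (sym (enum-ι↾ x)) (trans (cong (enum Q) ι↾x≡ι↾y) (enum-ι↾ y))))

  restrictAlong-↾ : ∀ (e : BoolFn n) A → (restrictAlong ι e ↾ Q′) A ≡ restrictAlong ι↾ (e ↾ Q) A
  restrictAlong-↾ e A = cong e (trans (image-image ι-inj (enum-injective Q′) (λ _ → refl) A)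
                                      (sym (image-image (enum-injective Q) ι↾-injective enum-ι↾ A)))

preimage-image-disjoint : ∀ {k l n} (ι : Fin k → Fin n) (κ : Fin l → Fin n) → (∀ x y → ι x ≢ κ y) →
                          ∀ X → preimage κ (image ι X) ≡ ∅
preimage-image-disjoint ι κ ι≢κ X = subset-ext λ y →
  trans (lookup-preimage κ (image ι X) y)
        (trans (lookup-image-∉range ι X (κ y) (λ x → ι≢κ x y)) (sym (lookup-∅ y)))

take-preimage : ∀ n {m} (A : Subset (n + m)) → take n A ≡ preimage (_↑ˡ m) A
take-preimage zero    A       = refl
take-preimage (suc n) (x ∷ A) = cong (x ∷_) (take-preimage n A)

drop-preimage : ∀ n {m} (A : Subset (n + m)) → drop n A ≡ preimage (n ↑ʳ_) A
drop-preimage zero    A       = sym (tabulate∘lookup A)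
drop-preimage (suc n) (x ∷ A) = drop-preimage n A

module ⋆₁-Blocks {n m} (f : BoolFn n) (g : BoolFn m) (f∅ : IsBool f) (g∅ : IsBool g) where

  private
    inl : Fin n → Fin (n + m)
    inl = _↑ˡ m
    inr : Fin m → Fin (n + m)
    inr = n ↑ʳ_
    inl-inj : Injective _≡_ _≡_ inl
    inl-inj = ↑ˡ-injective m _ _
    inr-inj : Injective _≡_ _≡_ inr
    inr-inj = ↑ʳ-injective n _ _

  ⋆₁-preimages : ∀ A → (f ⋆₁ g) A ≡ f (preimage inl A) +ℤ g (preimage inr A)
  ⋆₁-preimages A = cong₂ _+ℤ_ (cong f (take-preimage n A)) (cong g (drop-preimage n A))

  leftBlock : Subset (n + m)
  leftBlock = image inl ⊤

  preimage-inl-leftBlock : preimage inl leftBlock ≡ ⊤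
  preimage-inl-leftBlock = preimage-image inl inl-inj ⊤

  preimage-inr-leftBlock : preimage inr leftBlock ≡ ∅
  preimage-inr-leftBlock = preimage-image-disjoint inl inr ↑ˡ≢↑ʳ ⊤

  IsBool-⋆₁ : IsBool (f ⋆₁ g)
  IsBool-⋆₁ = trans (⋆₁-preimages ∅)
    (trans (cong₂ _+ℤ_ (trans (cong f (preimage-∅ inl)) f∅) (trans (cong g (preimage-∅ inr)) g∅)) (+-identityˡ _))

  ⋆₁-splits : Splits (f ⋆₁ g) leftBlock
  ⋆₁-splits A = begin
    (f ⋆₁ g) A                                                        ≡⟨ ⋆₁-preimages A ⟩
    f (preimage inl A) +ℤ g (preimage inr A)
      ≡⟨ cong₂ _+ℤ_ (sym (+-identityʳ (f (preimage inl A)))) (sym (+-identityˡ (g (preimage inr A)))) ⟩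
    (f (preimage inl A) +ℤ 0ℤ) +ℤ (0ℤ +ℤ g (preimage inr A))
      ≡⟨ cong₂ _+ℤ_ (cong₂ _+ℤ_ (cong f left-of-∩) (trans (sym g∅) (cong g right-of-∩)))
                    (cong₂ _+ℤ_ (trans (sym f∅) (cong f left-of-─)) (cong g right-of-─)) ⟩
    (f (preimage inl (A ∩ leftBlock)) +ℤ g (preimage inr (A ∩ leftBlock))) +ℤ
    (f (preimage inl (A ─ leftBlock)) +ℤ g (preimage inr (A ─ leftBlock)))
      ≡⟨ cong₂ _+ℤ_ (⋆₁-preimages (A ∩ leftBlock)) (⋆₁-preimages (A ─ leftBlock)) ⟨
    (f ⋆₁ g) (A ∩ leftBlock) +ℤ (f ⋆₁ g) (A ─ leftBlock)             ∎
    where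
    open ≡-Reasoning
    left-of-∩ : preimage inl A ≡ preimage inl (A ∩ leftBlock)
    left-of-∩ = sym (trans (preimage-∩ inl A leftBlock)
                           (trans (cong (preimage inl A ∩_) preimage-inl-leftBlock) (∩-identityʳ _)))
    right-of-∩ : ∅ ≡ preimage inr (A ∩ leftBlock)
    right-of-∩ = sym (trans (preimage-∩ inr A leftBlock)
                            (trans (cong (preimage inr A ∩_) preimage-inr-leftBlock) (∩-zeroʳ _)))
    left-of-─ : ∅ ≡ preimage inl (A ─ leftBlock)
    left-of-─ = sym (trans (preimage-─ inl A leftBlock)
                           (trans (cong (preimage inl A ─_) preimage-inl-leftBlock) (p─⊤≡⊥ _)))
    right-of-─ : preimage inr A ≡ preimage inr (A ─ leftBlock)
    right-of-─ = sym (trans (preimage-─ inr A leftBlock)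
                            (trans (cong (preimage inr A ─_) preimage-inr-leftBlock) (p─⊥≡p _)))

  inl-onto-leftBlock : ∀ {y} → lookup leftBlock y ≡ true → ∃ λ a → inl a ≡ y
  inl-onto-leftBlock {y} = image-inRange inl ⊤ y

  inr-onto-rightBlock : ∀ {y} → lookup (∁ leftBlock) y ≡ true → ∃ λ b → inr b ≡ y
  inr-onto-rightBlock {y} y∈∁L with splitView n m y
  ... | fromʳ b = b , refl
  ... | fromˡ a = ⊥-elim (true≢false (trans (sym y∈∁L) (lookup-∁-false leftBlock
                    (trans (lookup-image-at inl inl-inj ⊤ a) (lookup-replicate a true)))))

  κ₁ : Fin ∣ leftBlock ∣ → Fin n
  κ₁ x = proj₁ (inl-onto-leftBlock (enum-member leftBlock x))

  inl∘κ₁ : ∀ x → inl (κ₁ x) ≡ enum leftBlock x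
  inl∘κ₁ x = proj₂ (inl-onto-leftBlock (enum-member leftBlock x))

  κ₁-injective : Injective _≡_ _≡_ κ₁
  κ₁-injective {x} {y} κ₁x≡κ₁y = enum-injective leftBlock (trans (sym (inl∘κ₁ x)) (trans (cong inl κ₁x≡κ₁y) (inl∘κ₁ y)))

  κ₂ : Fin ∣ ∁ leftBlock ∣ → Fin m
  κ₂ x = proj₁ (inr-onto-rightBlock (enum-member (∁ leftBlock) x))

  inr∘κ₂ : ∀ x → inr (κ₂ x) ≡ enum (∁ leftBlock) x
  inr∘κ₂ x = proj₂ (inr-onto-rightBlock (enum-member (∁ leftBlock) x))

  κ₂-injective : Injective _≡_ _≡_ κ₂
  κ₂-injective {x} {y} κ₂x≡κ₂y = enum-injective (∁ leftBlock) (trans (sym (inr∘κ₂ x)) (trans (cong inr κ₂x≡κ₂y) (inr∘κ₂ y)))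

  ⋆₁-↾-leftBlock : ∀ A → ((f ⋆₁ g) ↾ leftBlock) A ≡ restrictAlong κ₁ f A
  ⋆₁-↾-leftBlock A = begin
    (f ⋆₁ g) (image (enum leftBlock) A)                                 ≡⟨ ⋆₁-preimages _ ⟩
    f (preimage inl (image (enum leftBlock) A)) +ℤ g (preimage inr (image (enum leftBlock) A))
      ≡⟨ cong (λ U → f (preimage inl U) +ℤ g (preimage inr U))
              (image-image inl-inj κ₁-injective inl∘κ₁ A) ⟨
    f (preimage inl (image inl X)) +ℤ g (preimage inr (image inl X))
      ≡⟨ cong₂ _+ℤ_ (cong f (preimage-image inl inl-inj X)) (trans (cong g (preimage-image-disjoint inl inr ↑ˡ≢↑ʳ X)) g∅) ⟩
    f X +ℤ 0ℤ                                                          ≡⟨ +-identityʳ _ ⟩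
    f X                                                                ∎
    where
    open ≡-Reasoning
    X = image κ₁ A

  ⋆₁-↾-rightBlock : ∀ A → ((f ⋆₁ g) ↾ ∁ leftBlock) A ≡ restrictAlong κ₂ g A
  ⋆₁-↾-rightBlock A = begin
    (f ⋆₁ g) (image (enum (∁ leftBlock)) A)                             ≡⟨ ⋆₁-preimages _ ⟩
    f (preimage inl (image (enum (∁ leftBlock)) A)) +ℤ g (preimage inr (image (enum (∁ leftBlock)) A))
      ≡⟨ cong (λ U → f (preimage inl U) +ℤ g (preimage inr U))
              (image-image inr-inj κ₂-injective inr∘κ₂ A) ⟨
    f (preimage inl (image inr X)) +ℤ g (preimage inr (image inr X))
      ≡⟨ cong₂ _+ℤ_ (trans (cong f (preimage-image-disjoint inr inl (λ b a → ↑ˡ≢↑ʳ a b ∘ sym) X)) f∅)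
                    (cong g (preimage-image inr inr-inj X)) ⟩
    0ℤ +ℤ g X                                                          ≡⟨ +-identityˡ _ ⟩
    g X                                                                ∎
    where
    open ≡-Reasoning
    X = image κ₂ A

Good : ∀ {n} → BoolFn n → Set
Good {n} e = ∀ {c} (ϖ : Fin n → Fin c) → Surjective _≡_ _≡_ ϖ → InEW e ϖ → InES e ϖ

-- Boolean functions are plain functions, so derivation is only meaningful up to pointwise equality.
data Derived {N} (h : BoolFn N) : ∀ {M} → BoolFn M → Set where
  self        : Derived h h
  restrict    : ∀ {M k} {e : BoolFn M} → Derived h e →
                (ι : Fin k → Fin M) → Injective _≡_ _≡_ ι → Derived h (restrictAlong ι e)
  quotient    : ∀ {M c} {e : BoolFn M} → Derived h e →
                (ϖ : Fin M → Fin c) → Surjective _≡_ _≡_ ϖ → InEW e ϖ → Derived h (e /∼ ϖ)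
  extensional : ∀ {M} {e e′ : BoolFn M} → Derived h e → (∀ A → e′ A ≡ e A) → Derived h e′

Derived-trans : ∀ {N N′ M} {h : BoolFn N} {h′ : BoolFn N′} {e : BoolFn M} → Derived h h′ → Derived h′ e → Derived h e
Derived-trans d self                        = d
Derived-trans d (restrict d′ ι ι-inj)       = restrict (Derived-trans d d′) ι ι-inj
Derived-trans d (quotient d′ ϖ ϖ-surj ϖ-EW) = quotient (Derived-trans d d′) ϖ ϖ-surj ϖ-EW
Derived-trans d (extensional d′ e′≗e)       = extensional (Derived-trans d d′) e′≗e

Derived-IsBool : ∀ {N M} {h : BoolFn N} {e : BoolFn M} → IsBool h → Derived h e → IsBool e
Derived-IsBool h∅ self                       = h∅
Derived-IsBool h∅ (restrict {e = e} d ι _)   = IsBool-restrictAlong ι e (Derived-IsBool h∅ d)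
Derived-IsBool h∅ (quotient {e = e} d ϖ _ _) = IsBool-/∼ ϖ e (Derived-IsBool h∅ d)
Derived-IsBool h∅ (extensional d e′≗e)       = trans (e′≗e ∅) (Derived-IsBool h∅ d)

HereditarilyGood : ∀ {N} → BoolFn N → Set
HereditarilyGood h = ∀ {M} {e : BoolFn M} → Derived h e → Good e

HasIc-empty : ∀ {M} {e : BoolFn M} → (Fin M → ⊥) → IsBool e → HasIc e 0
HasIc-empty {e = e} empty e∅ =
  (λ i → ⊥-elim (empty i)) , (λ ()) , (λ A → trans (cong e (subset-ext (λ i → ⊥-elim (empty i)))) e∅) , (λ ())

Good-empty : ∀ {M} {e : BoolFn M} → (Fin M → ⊥) → IsBool e → Good e
Good-empty {e = e} empty e∅ ϖ ϖ-surj ϖ-EW =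
  ϖ-EW , 0 , HasIc-empty (λ y → empty (section ϖ-surj y)) (IsBool-/∼ ϖ e e∅) , HasIc-empty empty e∅

Derived-one-empty : ∀ {M} {e : BoolFn M} → Derived one e → Fin M → ⊥
Derived-one-empty self                         ()
Derived-one-empty (restrict d ι _)             x = Derived-one-empty d (ι x)
Derived-one-empty (quotient d ϖ ϖ-surj _)      y = Derived-one-empty d (section ϖ-surj y)
Derived-one-empty (extensional d _)            x = Derived-one-empty d x

record ProductOfDerived {n m M} (f : BoolFn n) (g : BoolFn m) (e : BoolFn M) : Set where
  field
    isBool : IsBool e
    block  : Subset M
    splits : Splits e block
    left   : Derived f (e ↾ block)
    right  : Derived g (e ↾ ∁ block)

module _ {n m} {f : BoolFn n} {g : BoolFn m} where

  ProductOfDerived-⋆₁ : IsBool f → IsBool g → ProductOfDerived f g (f ⋆₁ g)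
  ProductOfDerived-⋆₁ f∅ g∅ = record
    { isBool = IsBool-⋆₁
    ; block  = leftBlock
    ; splits = ⋆₁-splits
    ; left   = extensional (restrict self κ₁ κ₁-injective) ⋆₁-↾-leftBlock
    ; right  = extensional (restrict self κ₂ κ₂-injective) ⋆₁-↾-rightBlock
    }
    where open ⋆₁-Blocks f g f∅ g∅

  ProductOfDerived-extensional : ∀ {M} {e e′ : BoolFn M} → ProductOfDerived f g e → (∀ A → e′ A ≡ e A) →
                                 ProductOfDerived f g e′
  ProductOfDerived-extensional pd e′≗e = record
    { isBool = trans (e′≗e ∅) isBool
    ; block  = block
    ; splits = λ A → trans (e′≗e A) (trans (splits A) (sym (cong₂ _+ℤ_ (e′≗e _) (e′≗e _))))
    ; left   = extensional left (λ A → e′≗e _)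
    ; right  = extensional right (λ A → e′≗e _)
    }
    where open ProductOfDerived pd

  ProductOfDerived-restrict : ∀ {M k} {e : BoolFn M} → ProductOfDerived f g e →
                              (ι : Fin k → Fin M) → Injective _≡_ _≡_ ι → ProductOfDerived f g (restrictAlong ι e)
  ProductOfDerived-restrict {e = e} pd ι ι-inj = record
    { isBool = IsBool-restrictAlong ι e isBool
    ; block  = preimage ι block
    ; splits = Splits-restrictAlong ι ι-inj splits
    ; left   = extensional (restrict left L.ι↾ L.ι↾-injective) (L.restrictAlong-↾ e)
    ; right  = extensional (restrict right R.ι↾ R.ι↾-injective) (R.restrictAlong-↾ e)
    }
    where
    open ProductOfDerived pd
    module L = RestrictionOnBlock ι ι-inj block (preimage ι block) refl
    module R = RestrictionOnBlock ι ι-inj (∁ block) (∁ (preimage ι block)) (preimage-∁ ι block)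

  module QuotientOfProduct {M c} {e : BoolFn M} (pd : ProductOfDerived f g e)
                           (ϖ : Fin M → Fin c) (ϖ-surj : Surjective _≡_ _≡_ ϖ) (ϖ-EW : InEW e ϖ) where
    open ProductOfDerived pd

    classes-indec : ∀ j → IndecOn e (cls ϖ j)
    classes-indec = InEW⇒IndecOn-classes e ϖ isBool ϖ-surj ϖ-EW

    block′ : Subset c
    block′ = quotientSubset e ϖ ϖ-surj isBool classes-indec block

    preimage-block′ : preimage ϖ block′ ≡ block
    preimage-block′ = preimage-quotientSubset e ϖ ϖ-surj isBool classes-indec splits

    splits′ : Splits (e /∼ ϖ) block′
    splits′ = Splits-/∼ ϖ preimage-block′ splits

    module L = QuotientOnBlock e ϖ ϖ-surj isBool classes-indec block block′ preimage-block′
    module R = QuotientOnBlock e ϖ ϖ-surj isBool classes-indec (∁ block) (∁ block′)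
                 (trans (preimage-∁ ϖ block′) (cong ∁ preimage-block′))

  ProductOfDerived-quotient : ∀ {M c} {e : BoolFn M} → ProductOfDerived f g e →
                              (ϖ : Fin M → Fin c) → Surjective _≡_ _≡_ ϖ → InEW e ϖ → ProductOfDerived f g (e /∼ ϖ)
  ProductOfDerived-quotient {e = e} pd ϖ ϖ-surj ϖ-EW = record
    { isBool = IsBool-/∼ ϖ e isBool
    ; block  = block′
    ; splits = splits′
    ; left   = extensional (quotient left L.ϖ↾ L.ϖ↾-surjective L.ϖ↾-InEW) L./∼-↾
    ; right  = extensional (quotient right R.ϖ↾ R.ϖ↾-surjective R.ϖ↾-InEW) R./∼-↾
    }
    where
    open ProductOfDerived pd
    open QuotientOfProduct pd ϖ ϖ-surj ϖ-EW

  Derived-⋆₁ : IsBool f → IsBool g → ∀ {M} {e : BoolFn M} → Derived (f ⋆₁ g) e → ProductOfDerived f g e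
  Derived-⋆₁ f∅ g∅ self                        = ProductOfDerived-⋆₁ f∅ g∅
  Derived-⋆₁ f∅ g∅ (restrict d ι ι-inj)        = ProductOfDerived-restrict (Derived-⋆₁ f∅ g∅ d) ι ι-inj
  Derived-⋆₁ f∅ g∅ (quotient d ϖ ϖ-surj ϖ-EW)  = ProductOfDerived-quotient (Derived-⋆₁ f∅ g∅ d) ϖ ϖ-surj ϖ-EW
  Derived-⋆₁ f∅ g∅ (extensional d e′≗e)        = ProductOfDerived-extensional (Derived-⋆₁ f∅ g∅ d) e′≗e

  ProductOfDerived⇒Good : HereditarilyGood f → HereditarilyGood g → ∀ {M} {e : BoolFn M} → ProductOfDerived f g e → Good e
  ProductOfDerived⇒Good f-good g-good {e = e} pd ϖ ϖ-surj ϖ-EW =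
    ϖ-EW , k₁ + k₂ ,
    HasIc-glue (e /∼ ϖ) block′ splits′ (HasIc-cong (λ B → sym (L./∼-↾ B)) ic₁/∼)
                                        (HasIc-cong (λ B → sym (R./∼-↾ B)) ic₂/∼) ,
    HasIc-glue e block splits ic₁ ic₂
    where
    open ProductOfDerived pd
    open QuotientOfProduct pd ϖ ϖ-surj ϖ-EW
    ES₁ = f-good left L.ϖ↾ L.ϖ↾-surjective L.ϖ↾-InEW
    ES₂ = g-good right R.ϖ↾ R.ϖ↾-surjective R.ϖ↾-InEW
    k₁ = proj₁ (proj₂ ES₁)
    k₂ = proj₁ (proj₂ ES₂)
    ic₁/∼ = proj₁ (proj₂ (proj₂ ES₁))
    ic₂/∼ = proj₁ (proj₂ (proj₂ ES₂))
    ic₁ = proj₂ (proj₂ (proj₂ ES₁))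
    ic₂ = proj₂ (proj₂ (proj₂ ES₂))

from-injective : ∀ {n m} (σ : Fin n ↔ Fin m) → Injective _≡_ _≡_ (Inverse.from σ)
from-injective σ {x} {y} fx≡fy = trans (sym (strictlyInverseˡ x)) (trans (cong to fx≡fy) (strictlyInverseˡ y))
  where open Inverse σ

image-from : ∀ {n m} (σ : Fin n ↔ Fin m) B → image (Inverse.from σ) B ≡ preimage (Inverse.to σ) B
image-from σ B = image-unique from (from-injective σ) B _
  (λ y → trans (lookup-preimage to B (from y)) (cong (lookup B) (strictlyInverseˡ y)))
  (λ x x∉from → ⊥-elim (x∉from (to x) (strictlyInverseʳ x)))
  where open Inverse σ

Bmax : Subspecies
Bmax = record
  { T       = λ _ h → IsBool h × HereditarilyGood h
  ; T⊆Bool  = proj₁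
  ; relabel = λ σ {f} {g} g≗f∘σ⁻¹ (f∅ , f-good) →
      let g-from-f : Derived f g
          g-from-f = extensional (restrict self (Inverse.from σ) (from-injective σ))
                                 (λ B → trans (g≗f∘σ⁻¹ B) (cong f (sym (image-from σ B))))
      in Derived-IsBool f∅ g-from-f , λ d → f-good (Derived-trans g-from-f d)
  }

Bmax-convenient : Convenient Bmax
Bmax-convenient = record
  { unit     = refl , λ d → Good-empty (Derived-one-empty d) (Derived-IsBool refl d)
  ; star     = λ {_} {_} {f} {g} (f∅ , f-good) (g∅ , g-good) →
                 ⋆₁-Blocks.IsBool-⋆₁ f g f∅ g∅ , λ d → ProductOfDerived⇒Good f-good g-good (Derived-⋆₁ f∅ g∅ d)
  ; restrict = λ ι ι-inj {f} (f∅ , f-good) →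
                 IsBool-restrictAlong ι f f∅ , λ d → f-good (Derived-trans (restrict self ι ι-inj) d)
  ; quotient = λ ϖ ϖ-surj {f} (f∅ , f-good) ϖ-EW →
                 IsBool-/∼ ϖ f f∅ , λ d → f-good (Derived-trans (quotient self ϖ ϖ-surj ϖ-EW) d)
  ; EW⊆ES    = λ ϖ ϖ-surj (_ , f-good) → f-good self ϖ ϖ-surj
  }

Convenient⇒⊑Bmax : ∀ S → Convenient S → S ⊑ Bmax
Convenient⇒⊑Bmax S S-convenient _ f f∈S = T⊆Bool S f∈S , λ d ϖ ϖ-surj → EW⊆ES ϖ ϖ-surj (derived-in-S d)
  where
  open Convenient S-convenient using (EW⊆ES) renaming (restrict to restrictˢ; quotient to quotientˢ)
  derived-in-S : ∀ {M} {e : BoolFn M} → Derived f e → T S M e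
  derived-in-S self                        = f∈S
  derived-in-S (restrict d ι ι-inj)        = restrictˢ ι ι-inj (derived-in-S d)
  derived-in-S (quotient d ϖ ϖ-surj ϖ-EW)  = quotientˢ ϖ ϖ-surj (derived-in-S d) ϖ-EW
  derived-in-S (extensional {M} {e} d e′≗e) =
    relabel S (↔-id (Fin M)) (λ B → trans (e′≗e B) (cong e (sym (tabulate∘lookup B)))) (derived-in-S d)

proposition3p24 : Σ Subspecies (λ Bmax → Convenient Bmax × (∀ (S : Subspecies) → Convenient S → Bmax ⊑ S → S ⊑ Bmax))
proposition3p24 = Bmax , Bmax-convenient , λ S S-convenient _ → Convenient⇒⊑Bmax S S-convenient
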